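{- For every integer $n\ge 1$, \[ \phi_{\{1,2,3\}}(n)=n^3\prod_{p\mid n}\left(1-\frac{1}{p}\right)\left(1-\frac{3}{p}+\frac{6-h(p)}{p^2}\right), \] where for a prime $p$: $h(p)=3$ if $p=3$, $h(p)=p-1$ if $p\equiv 1\pmod 3$, and $h(p)=p+1$ if $p\equiv 2\pmod 3$.
   Context: $\phi_{\{1,2,3\}}(n)$ is the number of $(a,b,c)\in\mathbb{Z}_n^3$ with $\gcd\big((a+b+c)(ab+bc+ca)abc,\,n\big)=1$. -}

module Defs where

open import Data.Nat as ℕ using (ℕ; zero; suc; _+_; _*_; _∸_; _%_; _≡ᵇ_)
open import Data.Nat.GCD using (gcd)
open import Data.Nat.Divisibility using (_∣?_)
open import Data.Nat.Primality using (prime?)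
open import Data.List using (List; length; filter; upTo; foldr; concatMap; map; _∷_; [])
open import Data.Product using (_×_; _,_)
open import Data.Integer as ℤ using (ℤ; +_)
open import Data.Rational as ℚ using (ℚ; 1ℚ; _/_)
open import Relation.Nullary.Decidable using (_×-dec_)
open import Relation.Binary.PropositionalEquality using (_≡_)

-- All triples (a,b,c) with 0 ≤ a,b,c < n, i.e. representatives of ℤ_n³.
triples : ℕ → List (ℕ × ℕ × ℕ)
triples n = concatMap (λ a → concatMap (λ b → map (λ c → (a , b , c)) (upTo n)) (upTo n)) (upTo n)

poly : ℕ × ℕ × ℕ → ℕ
poly (a , b , c) = (a + b + c) * (a * b + b * c + c * a) * (a * b * c)

phi123 : ℕ → ℕ
phi123 n = length (filter (λ t → gcd (poly t) n ℕ.≟ 1) (triples n))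

primeDivisors : ℕ → List ℕ
primeDivisors n = filter (λ p → prime? p ×-dec (p ∣? n)) (upTo (suc n))

h : ℕ → ℤ
h p with p % 3
... | 0 = + 3
... | 1 = + p ℤ.- + 1
... | _ = + p ℤ.+ + 1

-- The local factor (1 - 1/p)(1 - 3/p + (6 - h(p))/p²); p = 0 never occurs (p is prime).
localFactor : ℕ → ℚ
localFactor zero = 1ℚ
localFactor p@(suc k) =
  (1ℚ ℚ.- (+ 1 / p)) ℚ.* ((1ℚ ℚ.- (+ 3 / p)) ℚ.+ ((+ 6 ℤ.- h p) / (p * p)))

rhs : ℕ → ℚ
rhs n = (+ (n * n * n) / 1) ℚ.* foldr ℚ._*_ 1ℚ (map localFactor (primeDivisors n))

module Submission where

-- φ is multiplicative by the Chinese remainder theorem, and if a prime p divides m then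
-- φ(pm) = p³φ(m), because coprimality to pm and to m coincide. Modulo a prime p, fix
-- units a and b: then c must avoid 0, −(a+b) and the root of the linear form
-- ab + bc + ca = c(a+b) + ab, and the last two coincide exactly when p ∣ a² + ab + b².
-- Writing b = xa, this happens for r values of b, where r is the number of roots of
-- x² + x + 1 modulo p; hence φ(p) = (p−1)((p−2)² + 1 + r). Finally r ≤ 2, and the
-- order-three map x ↦ −1/(x+1), made to fix 0 and −1, has exactly these roots as its
-- other fixed points, so p ≡ 2 + r (mod 3).
-- Together these force r = p + 1 − h(p), which turns φ(p) into the local factor.

open import Algebra.Bundles using (CommutativeMonoid)
open import Data.Bool using (true; false; if_then_else_)
open import Data.Fin as Fin using (Fin; toℕ; fromℕ<; punchOut)
import Data.Fin.Properties as Fin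
open import Data.Integer as ℤ using (ℤ; +_)
import Data.Integer.Properties as ℤ
open import Data.List using (List; []; _∷_; [_]; _++_; length; filter; map; foldr; concatMap; upTo; applyUpTo)
open import Data.List.Properties using (filter-++; length-++; concatMap-++; concatMap-map; concatMap-pure; ++-identityʳ; upTo-∷ʳ)
open import Data.List.Relation.Unary.All using (All; []; _∷_)
open import Data.Nat as ℕ hiding (_/_)
open import Data.Nat.Properties
open import Data.Nat.DivMod hiding (_/_)
open import Data.Nat.Divisibility
open import Data.Nat.Coprimality using (Coprime; coprime-divisor; coprime⇒gcd≡1; gcd≡1⇒coprime)
import Data.Nat.Coprimality as Coprimality
open import Data.Nat.GCD using (gcd)
open import Data.Nat.ListAction using (product)
open import Data.Nat.Primality using (Prime; prime?; prime⇒irreducible; prime⇒nonZero; prime⇒nonTrivial; euclidsLemma; productOfPrimes≢0)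
open import Data.Nat.Primality.Factorisation using (PrimeFactorisation; factorise)
open import Data.Nat.Tactic.RingSolver using (solve-∀)
open import Data.Product using (_×_; _,_; proj₁; proj₂; ∃-syntax)
open import Data.Rational as ℚ using (ℚ; 1ℚ; _/_; toℚᵘ)
import Data.Rational.Properties as ℚ
open import Data.Rational.Solver using () renaming (module +-*-Solver to ℚ-Solver)
open import Data.Rational.Unnormalised as ℚᵘ using (ℚᵘ; mkℚᵘ; *≡*; _≃_)
import Data.Rational.Unnormalised.Properties as ℚᵘ
open import Data.Sum as Sum using (_⊎_; inj₁; inj₂; [_,_]′)
open import Relation.Binary using (tri<; tri≈; tri>)
open import Relation.Binary.PropositionalEquality using (_≡_; _≢_; refl; sym; trans; cong; cong₂; subst; subst₂; module ≡-Reasoning)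
open import Relation.Nullary using (¬_; Dec; yes; no; does; contradiction)
open import Relation.Nullary.Decidable using (_×-dec_; ¬?)
open import Algebra.Properties.CommutativeSemigroup +-commutativeSemigroup using () renaming (interchange to +-interchange)
open import Algebra.Properties.CommutativeSemigroup (CommutativeMonoid.commutativeSemigroup ℚ.*-1-commutativeMonoid)
  using () renaming (interchange to ℚ-*-interchange)
open import Defs
open ≡-Reasoning

-- Finite sums and indicators

∑< : ℕ → (ℕ → ℕ) → ℕ
∑< zero    f = 0
∑< (suc n) f = ∑< n f + f n

syntax ∑< n (λ x → e) = ∑[ x < n ] e

∑-cong : ∀ n {f g : ℕ → ℕ} → (∀ {x} → x < n → f x ≡ g x) → ∑< n f ≡ ∑< n g
∑-cong zero    f≗g = refl
∑-cong (suc n) f≗g = cong₂ _+_ (∑-cong n (λ x<n → f≗g (m<n⇒m<1+n x<n))) (f≗g ≤-refl)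

∑-zero : ∀ n {f : ℕ → ℕ} → (∀ {x} → x < n → f x ≡ 0) → ∑< n f ≡ 0
∑-zero zero    f≗0 = refl
∑-zero (suc n) f≗0 = cong₂ _+_ (∑-zero n (λ x<n → f≗0 (m<n⇒m<1+n x<n))) (f≗0 ≤-refl)

∑-mono-≤ : ∀ n {f g : ℕ → ℕ} → (∀ {x} → x < n → f x ≤ g x) → ∑< n f ≤ ∑< n g
∑-mono-≤ zero    f≤g = z≤n
∑-mono-≤ (suc n) f≤g = +-mono-≤ (∑-mono-≤ n (λ x<n → f≤g (m<n⇒m<1+n x<n))) (f≤g ≤-refl)

∑-const : ∀ n k → ∑[ x < n ] k ≡ n * k
∑-const zero    k = refl
∑-const (suc n) k = trans (cong (_+ k) (∑-const n k)) (+-comm (n * k) k)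

∑-distrib-+ : ∀ n (f g : ℕ → ℕ) → ∑[ x < n ] (f x + g x) ≡ ∑< n f + ∑< n g
∑-distrib-+ zero    f g = refl
∑-distrib-+ (suc n) f g =
  trans (cong (_+ (f n + g n)) (∑-distrib-+ n f g)) (+-interchange (∑< n f) (∑< n g) (f n) (g n))

∑-*ˡ : ∀ n k (f : ℕ → ℕ) → ∑[ x < n ] (k * f x) ≡ k * ∑< n f
∑-*ˡ zero    k f = sym (*-zeroʳ k)
∑-*ˡ (suc n) k f = trans (cong (_+ k * f n) (∑-*ˡ n k f)) (sym (*-distribˡ-+ k (∑< n f) (f n)))

∑-*ʳ : ∀ n k (f : ℕ → ℕ) → ∑[ x < n ] (f x * k) ≡ ∑< n f * k
∑-*ʳ n k f = begin
  ∑[ x < n ] (f x * k) ≡⟨ ∑-cong n (λ {x} _ → *-comm (f x) k) ⟩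
  ∑[ x < n ] (k * f x) ≡⟨ ∑-*ˡ n k f ⟩
  k * ∑< n f           ≡⟨ *-comm k (∑< n f) ⟩
  ∑< n f * k           ∎

∑-+ : ∀ m n (f : ℕ → ℕ) → ∑< (m + n) f ≡ ∑< m f + ∑[ x < n ] f (m + x)
∑-+ m zero    f = trans (cong (λ k → ∑< k f) (+-identityʳ m)) (sym (+-identityʳ (∑< m f)))
∑-+ m (suc n) f = begin
  ∑< (m + suc n) f                           ≡⟨ cong (λ k → ∑< k f) (+-suc m n) ⟩
  ∑< (m + n) f + f (m + n)                   ≡⟨ cong (_+ f (m + n)) (∑-+ m n f) ⟩
  ∑< m f + ∑[ x < n ] f (m + x) + f (m + n)  ≡⟨ +-assoc (∑< m f) _ _ ⟩
  ∑< m f + ∑[ x < suc n ] f (m + x)          ∎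

∑-* : ∀ k m (f : ℕ → ℕ) → ∑< (k * m) f ≡ ∑[ q < k ] ∑[ j < m ] f (q * m + j)
∑-* zero    m f = refl
∑-* (suc k) m f = begin
  ∑< (m + k * m) f                          ≡⟨ cong (λ n → ∑< n f) (+-comm m (k * m)) ⟩
  ∑< (k * m + m) f                          ≡⟨ ∑-+ (k * m) m f ⟩
  ∑< (k * m) f + ∑[ j < m ] f (k * m + j)   ≡⟨ cong (_+ ∑[ j < m ] f (k * m + j)) (∑-* k m f) ⟩
  ∑[ q < suc k ] ∑[ j < m ] f (q * m + j)   ∎

∑-comm : ∀ m n (f : ℕ → ℕ → ℕ) → ∑[ i < m ] ∑[ j < n ] f i j ≡ ∑[ j < n ] ∑[ i < m ] f i j
∑-comm zero    n f = sym (∑-zero n (λ _ → refl))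
∑-comm (suc m) n f = trans (cong (_+ ∑[ j < n ] f m j) (∑-comm m n f))
                           (sym (∑-distrib-+ n (λ j → ∑[ i < m ] f i j) (f m)))

𝟙 : {P : Set} → Dec P → ℕ
𝟙 P? = if does P? then 1 else 0

𝟙-yes : ∀ {P : Set} → P → (P? : Dec P) → 𝟙 P? ≡ 1
𝟙-yes p (yes _) = refl
𝟙-yes p (no ¬p) = contradiction p ¬p

𝟙-no : ∀ {P : Set} → ¬ P → (P? : Dec P) → 𝟙 P? ≡ 0
𝟙-no ¬p (yes p) = contradiction p ¬p
𝟙-no ¬p (no _)  = refl

𝟙-+-𝟙-¬ : ∀ {P : Set} (P? : Dec P) → 𝟙 P? + 𝟙 (¬? P?) ≡ 1
𝟙-+-𝟙-¬ (yes _) = refl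
𝟙-+-𝟙-¬ (no _)  = refl

𝟙-idem : ∀ {P : Set} (P? : Dec P) → 𝟙 P? * 𝟙 P? ≡ 𝟙 P?
𝟙-idem (yes _) = refl
𝟙-idem (no _)  = refl

𝟙-⇔ : ∀ {P Q : Set} → (P → Q) → (Q → P) → (P? : Dec P) (Q? : Dec Q) → 𝟙 P? ≡ 𝟙 Q?
𝟙-⇔ P⇒Q Q⇒P (yes p) Q? = sym (𝟙-yes (P⇒Q p) Q?)
𝟙-⇔ P⇒Q Q⇒P (no ¬p) Q? = sym (𝟙-no (λ q → ¬p (Q⇒P q)) Q?)

𝟙-× : ∀ {P Q : Set} (P? : Dec P) (Q? : Dec Q) → 𝟙 (P? ×-dec Q?) ≡ 𝟙 P? * 𝟙 Q?
𝟙-× (yes _) (yes _) = refl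
𝟙-× (yes _) (no _)  = refl
𝟙-× (no _)  _       = refl

𝟙-≤-+ : ∀ {P Q R : Set} → (P → Q ⊎ R) → (P? : Dec P) (Q? : Dec Q) (R? : Dec R) → 𝟙 P? ≤ 𝟙 Q? + 𝟙 R?
𝟙-≤-+ P⇒Q⊎R (no _)  Q? R? = z≤n
𝟙-≤-+ P⇒Q⊎R (yes p) Q? R? with P⇒Q⊎R p
... | inj₁ q = ≤-trans (≤-reflexive (sym (𝟙-yes q Q?))) (m≤m+n (𝟙 Q?) (𝟙 R?))
... | inj₂ r = ≤-trans (≤-reflexive (sym (𝟙-yes r R?))) (m≤n+m (𝟙 R?) (𝟙 Q?))

𝟙-¬-absorb : ∀ {P Q : Set} → (Q → ¬ P) → (P? : Dec P) (Q? : Dec Q) → 𝟙 (¬? P?) * 𝟙 Q? ≡ 𝟙 Q?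
𝟙-¬-absorb Q⇒¬P (yes p) (yes q) = contradiction p (Q⇒¬P q)
𝟙-¬-absorb Q⇒¬P (yes _) (no _)  = refl
𝟙-¬-absorb Q⇒¬P (no _)  (yes _) = refl
𝟙-¬-absorb Q⇒¬P (no _)  (no _)  = refl

𝟙-inclusion-exclusion : ∀ {P Q R : Set} → (P → ¬ Q) → (P → ¬ R) → (P? : Dec P) (Q? : Dec Q) (R? : Dec R) →
  𝟙 (¬? P?) * (𝟙 (¬? Q?) * 𝟙 (¬? R?)) + 𝟙 P? + 𝟙 Q? + 𝟙 R? ≡ 1 + 𝟙 Q? * 𝟙 R?
𝟙-inclusion-exclusion P⇒¬Q P⇒¬R (yes p) (yes q) _       = contradiction q (P⇒¬Q p)
𝟙-inclusion-exclusion P⇒¬Q P⇒¬R (yes p) (no _)  (yes r) = contradiction r (P⇒¬R p)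
𝟙-inclusion-exclusion P⇒¬Q P⇒¬R (yes _) (no _)  (no _)  = refl
𝟙-inclusion-exclusion P⇒¬Q P⇒¬R (no _)  (yes _) (yes _) = refl
𝟙-inclusion-exclusion P⇒¬Q P⇒¬R (no _)  (yes _) (no _)  = refl
𝟙-inclusion-exclusion P⇒¬Q P⇒¬R (no _)  (no _)  (yes _) = refl
𝟙-inclusion-exclusion P⇒¬Q P⇒¬R (no _)  (no _)  (no _)  = refl

∑-𝟙-≟ : ∀ n {k} (f : ℕ → ℕ) → k < n → ∑[ y < n ] (𝟙 (y ≟ k) * f y) ≡ f k
∑-𝟙-≟ (suc n) {k} f k<1+n with k ≟ n
... | yes refl = begin
  ∑[ y < k ] (𝟙 (y ≟ k) * f y) + 𝟙 (k ≟ k) * f k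
    ≡⟨ cong₂ _+_ (∑-zero k (λ {y} y<k → cong (_* f y) (𝟙-no (<⇒≢ y<k) (y ≟ k))))
                 (cong (_* f k) (𝟙-yes refl (k ≟ k))) ⟩
  0 + 1 * f k
    ≡⟨ +-identityʳ (f k) ⟩
  f k ∎
... | no k≢n = begin
  ∑[ y < n ] (𝟙 (y ≟ k) * f y) + 𝟙 (n ≟ k) * f n
    ≡⟨ cong₂ _+_ (∑-𝟙-≟ n f (≤∧≢⇒< (s≤s⁻¹ k<1+n) k≢n))
                 (cong (_* f n) (𝟙-no (λ n≡k → k≢n (sym n≡k)) (n ≟ k))) ⟩
  f k + 0
    ≡⟨ +-identityʳ (f k) ⟩
  f k ∎

∑-𝟙-unique : ∀ n {k} {P : ℕ → Set} (P? : ∀ x → Dec (P x)) → k < n →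
             (∀ {x} → x < n → P x → x ≡ k) → P k → ∑[ x < n ] 𝟙 (P? x) ≡ 1
∑-𝟙-unique n {k} P? k<n unique Pk = begin
  ∑[ x < n ] 𝟙 (P? x)           ≡⟨ ∑-cong n (λ {x} x<n → 𝟙-⇔ (unique x<n) (λ { refl → Pk }) (P? x) (x ≟ k)) ⟩
  ∑[ x < n ] 𝟙 (x ≟ k)          ≡⟨ ∑-cong n (λ {x} _ → sym (*-identityʳ (𝟙 (x ≟ k)))) ⟩
  ∑[ x < n ] (𝟙 (x ≟ k) * 1)    ≡⟨ ∑-𝟙-≟ n (λ _ → 1) k<n ⟩
  1                             ∎

SelfMap : ℕ → (ℕ → ℕ) → Set
SelfMap n g = ∀ {x} → x < n → g x < n

InjectiveOn : ℕ → (ℕ → ℕ) → Set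
InjectiveOn n g = ∀ {x y} → x < n → y < n → g x ≡ g y → x ≡ y

injective⇒surjective : ∀ {n g} → SelfMap n g → InjectiveOn n g → ∀ {y} → y < n → ∃[ x ] x < n × g x ≡ y
injective⇒surjective {suc m} {g} maps inj {y} y<n with Fin.any? (λ (i : Fin (suc m)) → g (toℕ i) ≟ y)
... | yes (i , gi≡y) = toℕ i , Fin.toℕ<n i , gi≡y
... | no y∉img = contradiction (Fin.injective⇒≤ punchOut-G-injective) (<-irrefl refl)
  where
  G : Fin (suc m) → Fin (suc m)
  G i = fromℕ< (maps (Fin.toℕ<n i))

  toℕ-G : ∀ i → toℕ (G i) ≡ g (toℕ i)
  toℕ-G i = Fin.toℕ-fromℕ< (maps (Fin.toℕ<n i))

  y≢G : ∀ i → fromℕ< y<n ≢ G i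
  y≢G i y≡Gi = y∉img (i , trans (sym (toℕ-G i)) (trans (cong toℕ (sym y≡Gi)) (Fin.toℕ-fromℕ< y<n)))

  punchOut-G-injective : ∀ {i j} → punchOut (y≢G i) ≡ punchOut (y≢G j) → i ≡ j
  punchOut-G-injective {i} {j} eq = Fin.toℕ-injective (inj (Fin.toℕ<n i) (Fin.toℕ<n j)
    (trans (sym (toℕ-G i)) (trans (cong toℕ (Fin.punchOut-injective (y≢G i) (y≢G j) eq)) (toℕ-G j))))

∑-permute : ∀ n (f : ℕ → ℕ) {g} → SelfMap n g → InjectiveOn n g → ∑[ x < n ] f (g x) ≡ ∑< n f
∑-permute n f {g} maps inj = begin
  ∑[ x < n ] f (g x)                          ≡⟨ ∑-cong n (λ x<n → sym (∑-𝟙-≟ n f (maps x<n))) ⟩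
  ∑[ x < n ] ∑[ y < n ] (𝟙 (y ≟ g x) * f y)  ≡⟨ ∑-comm n n (λ x y → 𝟙 (y ≟ g x) * f y) ⟩
  ∑[ y < n ] ∑[ x < n ] (𝟙 (y ≟ g x) * f y)  ≡⟨ ∑-cong n (λ {y} _ → ∑-*ʳ n (f y) (λ x → 𝟙 (y ≟ g x))) ⟩
  ∑[ y < n ] (∑[ x < n ] 𝟙 (y ≟ g x) * f y)  ≡⟨ ∑-cong n (λ {y} y<n → cong (_* f y) (fibre-size y<n)) ⟩
  ∑[ y < n ] (1 * f y)                        ≡⟨ ∑-cong n (λ {y} _ → *-identityˡ (f y)) ⟩
  ∑< n f                                      ∎
  where
  fibre-size : ∀ {y} → y < n → ∑[ x < n ] 𝟙 (y ≟ g x) ≡ 1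
  fibre-size {y} y<n with x , x<n , gx≡y ← injective⇒surjective maps inj y<n =
    ∑-𝟙-unique n (λ x → y ≟ g x) x<n (λ x'<n y≡gx' → inj x'<n x<n (trans (sym y≡gx') (sym gx≡y))) (sym gx≡y)

-- Congruences and coprimality

infix 4 _≡_[mod_]

_≡_[mod_] : ℕ → ℕ → (n : ℕ) → .{{NonZero n}} → Set
a ≡ b [mod n ] = a % n ≡ b % n

<∧∣⇒≡0 : ∀ {d x} .{{_ : NonZero d}} → x < d → d ∣ x → x ≡ 0
<∧∣⇒≡0 {d} {x} x<d d∣x = trans (sym (m<n⇒m%n≡m x<d)) (n∣m⇒m%n≡0 x d d∣x)

coprime-∣ : ∀ {x m k} → m ∣ k → Coprime x k → Coprime x m
coprime-∣ m∣k x⊥k (d∣x , d∣m) = x⊥k (d∣x , ∣-trans d∣m m∣k)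

coprime-* : ∀ {x m k} → Coprime x m → Coprime x k → Coprime x (m * k)
coprime-* {x} {m} x⊥m x⊥k {d} (d∣x , d∣mk) = x⊥k (d∣x , coprime-divisor d⊥m d∣mk)
  where
  d⊥m : Coprime d m
  d⊥m (e∣d , e∣m) = x⊥m (∣-trans e∣d d∣x , e∣m)

1<prime : ∀ {p} → Prime p → 1 < p
1<prime {p} p-prime = nonTrivial⇒n>1 p {{prime⇒nonTrivial p-prime}}

prime∤1 : ∀ {p} → Prime p → ¬ p ∣ 1
prime∤1 p-prime p∣1 = <⇒≢ (1<prime p-prime) (sym (∣1⇒≡1 p∣1))

prime∤* : ∀ {p x y} → Prime p → ¬ p ∣ x → ¬ p ∣ y → ¬ p ∣ x * y
prime∤* p-prime p∤x p∤y p∣xy = [ p∤x , p∤y ]′ (euclidsLemma _ _ p-prime p∣xy)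

prime∤⇒coprime : ∀ {p k} → Prime p → ¬ p ∣ k → Coprime p k
prime∤⇒coprime p-prime p∤k (d∣p , d∣k) with prime⇒irreducible p-prime d∣p
... | inj₁ d≡1 = d≡1
... | inj₂ d≡p = contradiction (subst (_∣ _) d≡p d∣k) p∤k

module _ {n : ℕ} .{{_ : NonZero n}} where

  %-≡[mod] : ∀ a → a % n ≡ a [mod n ]
  %-≡[mod] a = m%n%n≡m%n a n

  +-cong-mod : ∀ {a b c d} → a ≡ b [mod n ] → c ≡ d [mod n ] → a + c ≡ b + d [mod n ]
  +-cong-mod {a} {b} {c} {d} a≡b c≡d = begin
    (a + c) % n             ≡⟨ %-distribˡ-+ a c n ⟩
    (a % n + c % n) % n     ≡⟨ cong₂ (λ u v → (u + v) % n) a≡b c≡d ⟩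
    (b % n + d % n) % n     ≡⟨ %-distribˡ-+ b d n ⟨
    (b + d) % n             ∎

  *-cong-mod : ∀ {a b c d} → a ≡ b [mod n ] → c ≡ d [mod n ] → a * c ≡ b * d [mod n ]
  *-cong-mod {a} {b} {c} {d} a≡b c≡d = begin
    (a * c) % n             ≡⟨ %-distribˡ-* a c n ⟩
    (a % n * (c % n)) % n   ≡⟨ cong₂ (λ u v → (u * v) % n) a≡b c≡d ⟩
    (b % n * (d % n)) % n   ≡⟨ %-distribˡ-* b d n ⟨
    (b * d) % n             ∎

  ∣-resp-≡[mod] : ∀ {d a b} → d ∣ n → a ≡ b [mod n ] → d ∣ a → d ∣ b
  ∣-resp-≡[mod] d∣n a≡b d∣a = ∣n∣m%n⇒∣m d∣n (subst (_ ∣_) a≡b (%-presˡ-∣ d∣a d∣n))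

  coprime-resp-≡[mod] : ∀ {a b} → a ≡ b [mod n ] → Coprime a n → Coprime b n
  coprime-resp-≡[mod] a≡b coprime (d∣b , d∣n) = coprime (∣-resp-≡[mod] d∣n (sym a≡b) d∣b , d∣n)

  ≡[mod]⇒∣∸ : ∀ {a b} → a ≡ b [mod n ] → n ∣ a ∸ b
  ≡[mod]⇒∣∸ {a} {b} a≡b = divides (a ℕ./ n ∸ b ℕ./ n) (begin
    a ∸ b
      ≡⟨ cong₂ _∸_ (m≡m%n+[m/n]*n a n) (m≡m%n+[m/n]*n b n) ⟩
    (a % n + a ℕ./ n * n) ∸ (b % n + b ℕ./ n * n)
      ≡⟨ cong (λ r → (r + a ℕ./ n * n) ∸ (b % n + b ℕ./ n * n)) a≡b ⟩
    (b % n + a ℕ./ n * n) ∸ (b % n + b ℕ./ n * n)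
      ≡⟨ [m+n]∸[m+o]≡n∸o (b % n) _ _ ⟩
    a ℕ./ n * n ∸ b ℕ./ n * n
      ≡⟨ *-distribʳ-∸ n (a ℕ./ n) (b ℕ./ n) ⟨
    (a ℕ./ n ∸ b ℕ./ n) * n ∎)

  affine-injective : ∀ {k} l → Coprime n k → InjectiveOn n (λ x → (x * k + l) % n)
  affine-injective {k} l n⊥k x<n y<n eq = ≤-antisym (≤-from x<n eq) (≤-from y<n (sym eq))
    where
    ≤-from : ∀ {x y} → x < n → (x * k + l) % n ≡ (y * k + l) % n → x ≤ y
    ≤-from {x} {y} x<n eq = m∸n≡0⇒m≤n (<∧∣⇒≡0 (≤-<-trans (m∸n≤m x y) x<n) (coprime-divisor n⊥k n∣k[x∸y]))
      where
      n∣k[x∸y] : n ∣ k * (x ∸ y)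
      n∣k[x∸y] = subst (n ∣_) (begin
        (l + x * k) ∸ (l + y * k)  ≡⟨ [m+n]∸[m+o]≡n∸o l (x * k) (y * k) ⟩
        x * k ∸ y * k              ≡⟨ *-distribʳ-∸ k x y ⟨
        (x ∸ y) * k                ≡⟨ *-comm (x ∸ y) k ⟩
        k * (x ∸ y)                ∎)
        (≡[mod]⇒∣∸ (subst₂ (λ u v → u % n ≡ v % n) (+-comm (x * k) l) (+-comm (y * k) l) eq))

  ∑-𝟙-∣-affine : ∀ {k} l → Coprime n k → ∑[ x < n ] 𝟙 (n ∣? x * k + l) ≡ 1
  ∑-𝟙-∣-affine {k} l n⊥k = begin
    ∑[ x < n ] 𝟙 (n ∣? x * k + l)
      ≡⟨ ∑-cong n (λ {x} _ → 𝟙-⇔ (∣-resp-≡[mod] ∣-refl (sym (%-≡[mod] (x * k + l))))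
               (∣-resp-≡[mod] ∣-refl (%-≡[mod] (x * k + l)))
               (n ∣? x * k + l) (n ∣? (x * k + l) % n)) ⟩
    ∑[ x < n ] 𝟙 (n ∣? (x * k + l) % n)
      ≡⟨ ∑-permute n (λ y → 𝟙 (n ∣? y)) (λ {x} _ → m%n<n (x * k + l) n)
                    (affine-injective l n⊥k) ⟩
    ∑[ y < n ] 𝟙 (n ∣? y)
      ≡⟨ ∑-𝟙-unique n (n ∣?_) (>-nonZero⁻¹ n) (λ y<n n∣y → <∧∣⇒≡0 y<n n∣y) (n ∣0) ⟩
    1 ∎

[q*n+j]%n≡j : ∀ q {j n} .{{_ : NonZero n}} → j < n → (q * n + j) % n ≡ j
[q*n+j]%n≡j q {j} {n} j<n = trans (cong (_% n) (+-comm (q * n) j)) (trans ([m+kn]%n≡m%n j q n) (m<n⇒m%n≡m j<n))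

∑-periodic : ∀ k m .{{_ : NonZero m}} (f : ℕ → ℕ) → ∑[ x < k * m ] f (x % m) ≡ k * ∑< m f
∑-periodic k m f = begin
  ∑[ x < k * m ] f (x % m)
    ≡⟨ ∑-* k m _ ⟩
  ∑[ q < k ] ∑[ j < m ] f ((q * m + j) % m)
    ≡⟨ ∑-cong k (λ {q} _ → ∑-cong m (λ j<m → cong f ([q*n+j]%n≡j q j<m))) ⟩
  ∑[ q < k ] ∑< m f
    ≡⟨ ∑-const k (∑< m f) ⟩
  k * ∑< m f ∎

∑-crt : ∀ m n .{{_ : NonZero m}} .{{_ : NonZero n}} → Coprime m n → (A B : ℕ → ℕ) →
        ∑[ x < m * n ] (A (x % m) * B (x % n)) ≡ ∑< m A * ∑< n B
∑-crt m n m⊥n A B = begin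
  ∑[ x < m * n ] (A (x % m) * B (x % n))
    ≡⟨ ∑-* m n _ ⟩
  ∑[ q < m ] ∑[ j < n ] (A ((q * n + j) % m) * B ((q * n + j) % n))
    ≡⟨ ∑-cong m (λ {q} _ → ∑-cong n (λ {j} j<n →
         cong (λ r → A ((q * n + j) % m) * B r) ([q*n+j]%n≡j q j<n))) ⟩
  ∑[ q < m ] ∑[ j < n ] (A ((q * n + j) % m) * B j)
    ≡⟨ ∑-comm m n _ ⟩
  ∑[ j < n ] ∑[ q < m ] (A ((q * n + j) % m) * B j)
    ≡⟨ ∑-cong n (λ {j} _ → ∑-*ʳ m (B j) _) ⟩
  ∑[ j < n ] (∑[ q < m ] A ((q * n + j) % m) * B j)
    ≡⟨ ∑-cong n (λ {j} _ → cong (_* B j)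
         (∑-permute m A (λ {q} _ → m%n<n (q * n + j) m) (affine-injective j m⊥n))) ⟩
  ∑[ j < n ] (∑< m A * B j)
    ≡⟨ ∑-*ˡ n (∑< m A) B ⟩
  ∑< m A * ∑< n B ∎

-- Counting admissible triples

module _ {A : Set} {P : A → Set} (P? : ∀ x → Dec (P x)) where

  private
    length-filter-++ : ∀ xs ys → length (filter P? (xs ++ ys)) ≡ length (filter P? xs) + length (filter P? ys)
    length-filter-++ xs ys = trans (cong length (filter-++ P? xs ys)) (length-++ (filter P? xs))

    length-filter-singleton : ∀ x → length (filter P? [ x ]) ≡ 𝟙 (P? x)
    length-filter-singleton x with does (P? x)
    ... | true  = refl
    ... | false = refl

  length-filter-concatMap-upTo : ∀ n (f : ℕ → List A) →
    length (filter P? (concatMap f (upTo n))) ≡ ∑[ x < n ] length (filter P? (f x))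
  length-filter-concatMap-upTo zero    f = refl
  length-filter-concatMap-upTo (suc n) f = begin
    length (filter P? (concatMap f (upTo (suc n))))
      ≡⟨ cong (λ xs → length (filter P? (concatMap f xs))) (upTo-∷ʳ n) ⟨
    length (filter P? (concatMap f (upTo n ++ [ n ])))
      ≡⟨ cong (λ xs → length (filter P? xs)) (concatMap-++ f (upTo n) [ n ]) ⟩
    length (filter P? (concatMap f (upTo n) ++ (f n ++ [])))
      ≡⟨ length-filter-++ (concatMap f (upTo n)) (f n ++ []) ⟩
    length (filter P? (concatMap f (upTo n))) + length (filter P? (f n ++ []))
      ≡⟨ cong₂ _+_ (length-filter-concatMap-upTo n f) (cong (λ xs → length (filter P? xs)) (++-identityʳ (f n))) ⟩
    ∑[ x < suc n ] length (filter P? (f x))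
      ∎

  length-filter-map-upTo : ∀ n (g : ℕ → A) → length (filter P? (map g (upTo n))) ≡ ∑[ x < n ] 𝟙 (P? (g x))
  length-filter-map-upTo n g = begin
    length (filter P? (map g (upTo n)))
      ≡⟨ cong (λ xs → length (filter P? xs)) (trans (sym (concatMap-map [_] g (upTo n))) (concatMap-pure (map g (upTo n)))) ⟨
    length (filter P? (concatMap (λ x → [ g x ]) (upTo n)))
      ≡⟨ length-filter-concatMap-upTo n (λ x → [ g x ]) ⟩
    ∑[ x < n ] length (filter P? [ g x ])
      ≡⟨ ∑-cong n (λ {x} _ → length-filter-singleton (g x)) ⟩
    ∑[ x < n ] 𝟙 (P? (g x))
      ∎

χ : ℕ → ℕ → ℕ → ℕ → ℕ
χ n a b c = 𝟙 (gcd (poly (a , b , c)) n ≟ 1)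

Φ : ℕ → ℕ
Φ n = ∑[ a < n ] ∑[ b < n ] ∑[ c < n ] χ n a b c

phi123≡Φ : ∀ n → phi123 n ≡ Φ n
phi123≡Φ n = begin
  phi123 n
    ≡⟨ length-filter-concatMap-upTo P? n _ ⟩
  ∑[ a < n ] length (filter P? (concatMap (λ b → map (λ c → (a , b , c)) (upTo n)) (upTo n)))
    ≡⟨ ∑-cong n (λ _ → trans (length-filter-concatMap-upTo P? n _) (∑-cong n (λ _ → length-filter-map-upTo P? n _))) ⟩
  Φ n
    ∎
  where
  P? : ∀ t → Dec (gcd (poly t) n ≡ 1)
  P? t = gcd (poly t) n ≟ 1

private
  𝟙-coprime-⇔ : ∀ {m n} x y → (Coprime x m → Coprime y n) → (Coprime y n → Coprime x m) →
                𝟙 (gcd x m ≟ 1) ≡ 𝟙 (gcd y n ≟ 1)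
  𝟙-coprime-⇔ {m} {n} x y to from = 𝟙-⇔ (λ eq → coprime⇒gcd≡1 (to (gcd≡1⇒coprime {x} {m} eq)))
                                        (λ eq → coprime⇒gcd≡1 (from (gcd≡1⇒coprime {y} {n} eq)))
                                        (gcd x m ≟ 1) (gcd y n ≟ 1)

poly-≡[mod] : ∀ {n} .{{_ : NonZero n}} a b c → poly (a , b , c) ≡ poly (a % n , b % n , c % n) [mod n ]
poly-≡[mod] {n} a b c =
  *-cong-mod (*-cong-mod (+-cong-mod (+-cong-mod a≡ b≡) c≡)
                         (+-cong-mod (+-cong-mod (*-cong-mod a≡ b≡) (*-cong-mod b≡ c≡)) (*-cong-mod c≡ a≡)))
             (*-cong-mod (*-cong-mod a≡ b≡) c≡)
  where
  a≡ : a ≡ a % n [mod n ]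
  a≡ = sym (%-≡[mod] a)
  b≡ : b ≡ b % n [mod n ]
  b≡ = sym (%-≡[mod] b)
  c≡ : c ≡ c % n [mod n ]
  c≡ = sym (%-≡[mod] c)

χ-% : ∀ n .{{_ : NonZero n}} a b c → χ n a b c ≡ χ n (a % n) (b % n) (c % n)
χ-% n a b c = 𝟙-coprime-⇔ (poly (a , b , c)) (poly (a % n , b % n , c % n))
  (coprime-resp-≡[mod] (poly-≡[mod] a b c)) (coprime-resp-≡[mod] (sym (poly-≡[mod] a b c)))

χ-* : ∀ m k a b c → χ (m * k) a b c ≡ χ m a b c * χ k a b c
χ-* m k a b c = trans (𝟙-⇔ split join (gcd x (m * k) ≟ 1) ((gcd x m ≟ 1) ×-dec (gcd x k ≟ 1)))
                      (𝟙-× (gcd x m ≟ 1) (gcd x k ≟ 1))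
  where
  x : ℕ
  x = poly (a , b , c)
  split : gcd x (m * k) ≡ 1 → gcd x m ≡ 1 × gcd x k ≡ 1
  split eq = coprime⇒gcd≡1 (coprime-∣ (m∣m*n k) x⊥mk) , coprime⇒gcd≡1 (coprime-∣ (n∣m*n m) x⊥mk)
    where
    x⊥mk : Coprime x (m * k)
    x⊥mk = gcd≡1⇒coprime {x} {m * k} eq
  join : gcd x m ≡ 1 × gcd x k ≡ 1 → gcd x (m * k) ≡ 1
  join (eq₁ , eq₂) = coprime⇒gcd≡1 (coprime-* (gcd≡1⇒coprime {x} {m} eq₁) (gcd≡1⇒coprime {x} {k} eq₂))

χ-∣ : ∀ {k m} → k ∣ m → ∀ a b c → χ (k * m) a b c ≡ χ m a b c
χ-∣ {k} k∣m a b c = 𝟙-coprime-⇔ (poly (a , b , c)) (poly (a , b , c))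
  (coprime-∣ (n∣m*n k)) (λ x⊥m → coprime-* (coprime-∣ k∣m x⊥m) x⊥m)

Φ-∣ : ∀ k m .{{_ : NonZero m}} → k ∣ m → Φ (k * m) ≡ k * k * k * Φ m
Φ-∣ k m k∣m = begin
  Φ (k * m)
    ≡⟨ ∑-cong (k * m) (λ {a} _ → ∑-cong (k * m) (λ {b} _ → ∑-cong (k * m) (λ {c} _ →
         trans (χ-∣ k∣m a b c) (χ-% m a b c)))) ⟩
  ∑[ a < k * m ] ∑[ b < k * m ] ∑[ c < k * m ] χ m (a % m) (b % m) (c % m)
    ≡⟨ ∑-cong (k * m) (λ {a} _ → ∑-cong (k * m) (λ {b} _ → ∑-periodic k m (χ m (a % m) (b % m)))) ⟩
  ∑[ a < k * m ] ∑[ b < k * m ] (k * ∑[ c < m ] χ m (a % m) (b % m) c)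
    ≡⟨ ∑-cong (k * m) (λ {a} _ → ∑-periodic k m (λ b → k * ∑[ c < m ] χ m (a % m) b c)) ⟩
  ∑[ a < k * m ] (k * ∑[ b < m ] (k * ∑[ c < m ] χ m (a % m) b c))
    ≡⟨ ∑-periodic k m (λ a → k * ∑[ b < m ] (k * ∑[ c < m ] χ m a b c)) ⟩
  k * ∑[ a < m ] (k * ∑[ b < m ] (k * ∑[ c < m ] χ m a b c))
    ≡⟨ cong (k *_) (trans (∑-cong m (λ _ → cong (k *_) (∑-*ˡ m k _))) (trans (∑-*ˡ m k _) (cong (k *_) (∑-*ˡ m k _)))) ⟩
  k * (k * (k * Φ m))
    ≡⟨ k*[k*[k*x]]≡k*k*k*x k (Φ m) ⟩
  k * k * k * Φ m
    ∎
  where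
  k*[k*[k*x]]≡k*k*k*x : ∀ k x → k * (k * (k * x)) ≡ k * k * k * x
  k*[k*[k*x]]≡k*k*k*x = solve-∀

Φ-coprime : ∀ m n .{{_ : NonZero m}} .{{_ : NonZero n}} → Coprime m n → Φ (m * n) ≡ Φ m * Φ n
Φ-coprime m n m⊥n = begin
  Φ (m * n)
    ≡⟨ ∑-cong (m * n) (λ {a} _ → ∑-cong (m * n) (λ {b} _ → ∑-cong (m * n) (λ {c} _ →
         trans (χ-* m n a b c) (cong₂ _*_ (χ-% m a b c) (χ-% n a b c))))) ⟩
  ∑[ a < m * n ] ∑[ b < m * n ] ∑[ c < m * n ] (χ m (a % m) (b % m) (c % m) * χ n (a % n) (b % n) (c % n))
    ≡⟨ ∑-cong (m * n) (λ {a} _ → ∑-cong (m * n) (λ {b} _ →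
         ∑-crt m n m⊥n (χ m (a % m) (b % m)) (χ n (a % n) (b % n)))) ⟩
  ∑[ a < m * n ] ∑[ b < m * n ] (∑[ c < m ] χ m (a % m) (b % m) c * ∑[ c < n ] χ n (a % n) (b % n) c)
    ≡⟨ ∑-cong (m * n) (λ {a} _ → ∑-crt m n m⊥n (λ b → ∑[ c < m ] χ m (a % m) b c) (λ b → ∑[ c < n ] χ n (a % n) b c)) ⟩
  ∑[ a < m * n ] (∑[ b < m ] ∑[ c < m ] χ m (a % m) b c * ∑[ b < n ] ∑[ c < n ] χ n (a % n) b c)
    ≡⟨ ∑-crt m n m⊥n (λ a → ∑[ b < m ] ∑[ c < m ] χ m a b c) (λ a → ∑[ b < n ] ∑[ c < n ] χ n a b c) ⟩
  Φ m * Φ n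
    ∎

-- Permutations of order three

isMin : ℕ → ℕ → ℕ → ℕ
isMin x y z = 𝟙 ((x <? y) ×-dec (x <? z))

private
  isMin-yes : ∀ {x y z} → x < y → x < z → isMin x y z ≡ 1
  isMin-yes {x} {y} {z} x<y x<z = 𝟙-yes (x<y , x<z) ((x <? y) ×-dec (x <? z))

  isMin-no₁ : ∀ {x y} z → ¬ x < y → isMin x y z ≡ 0
  isMin-no₁ {x} {y} z x≮y = 𝟙-no (λ (x<y , _) → x≮y x<y) ((x <? y) ×-dec (x <? z))

  isMin-no₂ : ∀ {x} y {z} → ¬ x < z → isMin x y z ≡ 0
  isMin-no₂ {x} y {z} x≮z = 𝟙-no (λ (_ , x<z) → x≮z x<z) ((x <? y) ×-dec (x <? z))

exactly-one-isMin : ∀ {x y z} → x ≢ y → y ≢ z → z ≢ x → isMin x y z + isMin y z x + isMin z x y ≡ 1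
exactly-one-isMin {x} {y} {z} x≢y y≢z z≢x with <-cmp x y | <-cmp y z | <-cmp z x
... | tri≈ _ x≡y _ | _            | _            = contradiction x≡y x≢y
... | _            | tri≈ _ y≡z _ | _            = contradiction y≡z y≢z
... | _            | _            | tri≈ _ z≡x _ = contradiction z≡x z≢x
... | tri< x<y _ _ | tri< y<z _ _ | tri< z<x _ _ = contradiction z<x (<-asym (<-trans x<y y<z))
... | tri> _ _ y<x | tri> _ _ z<y | tri> _ _ x<z = contradiction x<z (<-asym (<-trans z<y y<x))
... | tri< x<y _ _ | tri< y<z _ _ | tri> _ _ x<z
  = cong₂ _+_ (cong₂ _+_ (isMin-yes x<y x<z) (isMin-no₂ z (<-asym x<y))) (isMin-no₁ y (<-asym x<z))
... | tri< x<y _ _ | tri> _ _ z<y | tri< z<x _ _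
  = cong₂ _+_ (cong₂ _+_ (isMin-no₂ y (<-asym z<x)) (isMin-no₁ x (<-asym z<y))) (isMin-yes z<x (<-trans z<x x<y))
... | tri< x<y _ _ | tri> _ _ z<y | tri> _ _ x<z
  = cong₂ _+_ (cong₂ _+_ (isMin-yes x<y x<z) (isMin-no₂ z (<-asym x<y))) (isMin-no₁ y (<-asym x<z))
... | tri> _ _ y<x | tri< y<z _ _ | tri< z<x _ _
  = cong₂ _+_ (cong₂ _+_ (isMin-no₁ z (<-asym y<x)) (isMin-yes y<z y<x)) (isMin-no₂ x (<-asym y<z))
... | tri> _ _ y<x | tri< y<z _ _ | tri> _ _ x<z
  = cong₂ _+_ (cong₂ _+_ (isMin-no₁ z (<-asym y<x)) (isMin-yes y<z y<x)) (isMin-no₂ x (<-asym y<z))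
... | tri> _ _ y<x | tri> _ _ z<y | tri< z<x _ _
  = cong₂ _+_ (cong₂ _+_ (isMin-no₁ z (<-asym y<x)) (isMin-no₁ x (<-asym z<y))) (isMin-yes z<x z<y)

orbitLeader : (ℕ → ℕ) → ℕ → ℕ
orbitLeader σ x = isMin x (σ x) (σ (σ x))

𝟙-fixed+leaders≡1 : ∀ σ {x} → σ (σ (σ x)) ≡ x →
  𝟙 (σ x ≟ x) + (orbitLeader σ x + orbitLeader σ (σ x) + orbitLeader σ (σ (σ x))) ≡ 1
𝟙-fixed+leaders≡1 σ {x} σ³x≡x with σ x ≟ x
... | yes σx≡x = cong₂ _+_ (𝟙-yes σx≡x (σ x ≟ x))
  (cong₂ _+_ (cong₂ _+_ (no-leader σx≡x) (no-leader (cong σ σx≡x))) (no-leader (cong (λ w → σ (σ w)) σx≡x)))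
  where
  no-leader : ∀ {w} → σ w ≡ w → orbitLeader σ w ≡ 0
  no-leader {w} σw≡w = isMin-no₁ (σ (σ w)) (λ w<σw → <-irrefl (sym σw≡w) w<σw)
... | no σx≢x = begin
  𝟙 (σ x ≟ x) + (orbitLeader σ x + orbitLeader σ (σ x) + orbitLeader σ (σ (σ x)))
    ≡⟨ cong (_+ (orbitLeader σ x + orbitLeader σ (σ x) + orbitLeader σ (σ (σ x)))) (𝟙-no σx≢x (σ x ≟ x)) ⟩
  orbitLeader σ x + orbitLeader σ (σ x) + orbitLeader σ (σ (σ x))
    ≡⟨ cong₂ (λ u v → orbitLeader σ x + isMin (σ x) (σ (σ x)) u + isMin (σ (σ x)) u v) σ³x≡x (cong σ σ³x≡x) ⟩
  isMin x (σ x) (σ (σ x)) + isMin (σ x) (σ (σ x)) x + isMin (σ (σ x)) x (σ x)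
    ≡⟨ exactly-one-isMin (λ x≡σx → σx≢x (sym x≡σx)) σx≢σ²x σ²x≢x ⟩
  1 ∎
  where
  σ²x≢x : σ (σ x) ≢ x
  σ²x≢x σ²x≡x = σx≢x (trans (sym (cong σ σ²x≡x)) σ³x≡x)
  σx≢σ²x : σ x ≢ σ (σ x)
  σx≢σ²x σx≡σ²x = σ²x≢x (trans (cong σ σx≡σ²x) σ³x≡x)

fixedPoints+3*orbits≡n : ∀ n σ → SelfMap n σ → (∀ {x} → x < n → σ (σ (σ x)) ≡ x) →
  ∑[ x < n ] 𝟙 (σ x ≟ x) + 3 * ∑[ x < n ] orbitLeader σ x ≡ n
fixedPoints+3*orbits≡n n σ σ-maps σ³≡id = begin
  F + 3 * L                                                   ≡⟨ cong (_+_ F) 3*L≡L+Lσ+Lσ² ⟩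
  F + (L + ∑[ x < n ] leader (σ x) + ∑[ x < n ] leader (σ (σ x)))
    ≡⟨ cong (_+_ F) (cong (_+ ∑[ x < n ] leader (σ (σ x))) (∑-distrib-+ n leader (λ x → leader (σ x)))) ⟨
  F + (∑[ x < n ] (leader x + leader (σ x)) + ∑[ x < n ] leader (σ (σ x)))
    ≡⟨ cong (_+_ F) (∑-distrib-+ n _ _) ⟨
  F + ∑[ x < n ] (leader x + leader (σ x) + leader (σ (σ x)))
    ≡⟨ ∑-distrib-+ n _ _ ⟨
  ∑[ x < n ] (𝟙 (σ x ≟ x) + (leader x + leader (σ x) + leader (σ (σ x))))
    ≡⟨ ∑-cong n (λ x<n → 𝟙-fixed+leaders≡1 σ (σ³≡id x<n)) ⟩
  ∑[ x < n ] 1                                                ≡⟨ ∑-const n 1 ⟩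
  n * 1                                                       ≡⟨ *-identityʳ n ⟩
  n                                                           ∎
  where
  leader : ℕ → ℕ
  leader = orbitLeader σ
  F L : ℕ
  F = ∑[ x < n ] 𝟙 (σ x ≟ x)
  L = ∑< n leader
  σ-injective : InjectiveOn n σ
  σ-injective {x} {y} x<n y<n σx≡σy = trans (sym (σ³≡id x<n)) (trans (cong (λ w → σ (σ w)) σx≡σy) (σ³≡id y<n))
  σ²-injective : InjectiveOn n (λ x → σ (σ x))
  σ²-injective x<n y<n σ²x≡σ²y = σ-injective x<n y<n (σ-injective (σ-maps x<n) (σ-maps y<n) σ²x≡σ²y)
  3*L≡L+Lσ+Lσ² : 3 * L ≡ L + ∑[ x < n ] leader (σ x) + ∑[ x < n ] leader (σ (σ x))
  3*L≡L+Lσ+Lσ² = begin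
    3 * L
      ≡⟨ cong (λ u → L + (L + u)) (+-identityʳ L) ⟩
    L + (L + L)
      ≡⟨ +-assoc L L L ⟨
    L + L + L
      ≡⟨ cong₂ (λ u v → L + u + v) (∑-permute n leader σ-maps σ-injective)
                                   (∑-permute n leader (λ x<n → σ-maps (σ-maps x<n)) σ²-injective) ⟨
    L + ∑[ x < n ] leader (σ x) + ∑[ x < n ] leader (σ (σ x)) ∎

-- Roots of x² + x + 1 modulo a prime

cyclo₃ : ℕ → ℕ
cyclo₃ x = x * x + x + 1

#cyclo₃-roots : ℕ → ℕ
#cyclo₃-roots p = ∑[ x < p ] 𝟙 (p ∣? cyclo₃ x)

module _ {p : ℕ} (p-prime : Prime p) where

  private
    instance
      p≢0 : NonZero p
      p≢0 = prime⇒nonZero p-prime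

    1<p : 1 < p
    1<p = 1<prime p-prime

    p∤1 : ¬ p ∣ 1
    p∤1 = prime∤1 p-prime

    p∤small : ∀ {x} → 0 < x → x < p → ¬ p ∣ x
    p∤small 0<x x<p p∣x = <⇒≢ 0<x (sym (<∧∣⇒≡0 x<p p∣x))

  Inner : ℕ → Set
  Inner x = 0 < x × suc x < p

  inner? : ∀ x → Dec (Inner x)
  inner? x = (0 <? x) ×-dec (suc x <? p)

  private
    p⊥1+x : ∀ {x} → Inner x → Coprime p (suc x)
    p⊥1+x (_ , 1+x<p) = prime∤⇒coprime p-prime (p∤small z<s 1+x<p)

  -- x ↦ −1/(x+1) has order three on the projective line and permutes the inner points;
  -- its remaining orbit 0 ↦ −1 ↦ ∞ leaves ℤ/p, so σ fixes 0 and p − 1 instead.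
  σ : ℕ → ℕ
  σ x with inner? x | Fin.any? (λ (y : Fin p) → p ∣? toℕ y * suc x + 1)
  ... | yes _ | yes (y , _) = toℕ y
  ... | _     | _           = x

  σ-outer : ∀ {x} → ¬ Inner x → σ x ≡ x
  σ-outer {x} outer with inner? x
  ... | yes inner = contradiction inner outer
  ... | no _      = refl

  σ-inner : ∀ {x} → Inner x → σ x < p × p ∣ σ x * suc x + 1
  σ-inner {x} inner with inner? x | Fin.any? (λ (y : Fin p) → p ∣? toℕ y * suc x + 1)
  ... | no outer | _            = contradiction inner outer
  ... | yes _    | yes (y , p∣) = Fin.toℕ<n y , p∣
  ... | yes _    | no none      =
    contradiction (∑-𝟙-∣-affine 1 (p⊥1+x inner)) (λ #≡1 → 0≢1+n (trans (sym no-solution) #≡1))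
    where
    no-solution : ∑[ y < p ] 𝟙 (p ∣? y * suc x + 1) ≡ 0
    no-solution = ∑-zero p (λ {y} y<p → 𝟙-no
      (λ p∣ → none (fromℕ< y<p , subst (λ z → p ∣ z * suc x + 1) (sym (Fin.toℕ-fromℕ< y<p)) p∣))
                                             (p ∣? y * suc x + 1))

  σ-unique : ∀ {x y} → Inner x → y < p → p ∣ y * suc x + 1 → σ x ≡ y
  σ-unique {x} {y} inner y<p p∣ with σx<p , p∣σ ← σ-inner inner =
    affine-injective 1 (p⊥1+x inner) σx<p y<p (trans (n∣m⇒m%n≡0 _ p p∣σ) (sym (n∣m⇒m%n≡0 _ p p∣)))

  private
    inverse-inner : ∀ {x y} → Inner x → y < p → p ∣ y * suc x + 1 → Inner y
    inverse-inner {x} {zero}  _             _     p∣1 = contradiction p∣1 p∤1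
    inverse-inner {x} {suc y} (0<x , 1+x<p) 1+y<p p∣  = z<s , ≤∧≢⇒< 1+y<p 2+y≢p
      where
      2+y≢p : suc (suc y) ≢ p
      2+y≢p 2+y≡p = p∤small 0<x (<-trans (n<1+n x) 1+x<p) (∣m+n∣m⇒∣n p∣[1+y][1+x]+1+x p∣)
        where
        p∣[1+y][1+x]+1+x : p ∣ suc y * suc x + 1 + x
        p∣[1+y][1+x]+1+x = subst (p ∣_) (identity y x) (subst (λ q → p ∣ q * suc x) (sym 2+y≡p) (m∣m*n (suc x)))
          where
          identity : ∀ y x → suc (suc y) * suc x ≡ suc y * suc x + 1 + x
          identity = solve-∀

    inner-cases : ∀ x {C : Set} → (Inner x → C) → (¬ Inner x → C) → C
    inner-cases x f g with inner? x
    ... | yes inner = f inner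
    ... | no outer  = g outer

  σ-maps : SelfMap p σ
  σ-maps {x} x<p = inner-cases x (λ inner → proj₁ (σ-inner inner)) (λ outer → subst (_< p) (sym (σ-outer outer)) x<p)

  private
    σ³≡id-inner : ∀ {x} → x < p → Inner x → σ (σ (σ x)) ≡ x
    σ³≡id-inner {x} x<p x-inner = σ-unique z-inner x<p p∣x[1+z]+1
      where
      y z : ℕ
      y = σ x
      z = σ y
      p∣y[1+x]+1 : p ∣ y * suc x + 1
      p∣y[1+x]+1 = proj₂ (σ-inner x-inner)
      y-inner : Inner y
      y-inner = inverse-inner x-inner (proj₁ (σ-inner x-inner)) p∣y[1+x]+1
      p∣z[1+y]+1 : p ∣ z * suc y + 1
      p∣z[1+y]+1 = proj₂ (σ-inner y-inner)
      z-inner : Inner z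
      z-inner = inverse-inner y-inner (proj₁ (σ-inner y-inner)) p∣z[1+y]+1
      identity : ∀ x y z → suc y * (x * suc z + 1) ≡ x * (z * suc y + 1) + (y * suc x + 1)
      identity = solve-∀
      p∣[1+y][x[1+z]+1] : p ∣ suc y * (x * suc z + 1)
      p∣[1+y][x[1+z]+1] = subst (p ∣_) (sym (identity x y z)) (∣m∣n⇒∣m+n (∣n⇒∣m*n x p∣z[1+y]+1) p∣y[1+x]+1)
      p∣x[1+z]+1 : p ∣ x * suc z + 1
      p∣x[1+z]+1 = [ (λ p∣1+y → contradiction p∣1+y (p∤small z<s (proj₂ y-inner))) , (λ p∣ → p∣) ]′
                     (euclidsLemma (suc y) (x * suc z + 1) p-prime p∣[1+y][x[1+z]+1])

  σ³≡id : ∀ {x} → x < p → σ (σ (σ x)) ≡ x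
  σ³≡id {x} x<p = inner-cases x (σ³≡id-inner x<p) (λ outer →
    trans (cong (λ w → σ (σ w)) (σ-outer outer)) (trans (cong σ (σ-outer outer)) (σ-outer outer)))

  private
    cyclo₃≡x*[1+x]+1 : ∀ x → x * x + x + 1 ≡ x * suc x + 1
    cyclo₃≡x*[1+x]+1 = solve-∀

    𝟙-σ-fixed : ∀ {x} → x < p → 𝟙 (σ x ≟ x) ≡ 𝟙 (x ≟ 0) + 𝟙 (suc x ≟ p) + 𝟙 (p ∣? cyclo₃ x)
    𝟙-σ-fixed {zero} _ = begin
      𝟙 (σ 0 ≟ 0)
        ≡⟨ 𝟙-yes (σ-outer (λ ())) (σ 0 ≟ 0) ⟩
      1
        ≡⟨ cong₂ (λ u v → 1 + u + v) (𝟙-no (<⇒≢ 1<p) (1 ≟ p)) (𝟙-no p∤1 (p ∣? 1)) ⟨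
      1 + 𝟙 (1 ≟ p) + 𝟙 (p ∣? 1) ∎
    𝟙-σ-fixed {suc x} 1+x<p = inner-cases (suc x) fixed-inner fixed-outer
      where
      fixed-inner : Inner (suc x) → 𝟙 (σ (suc x) ≟ suc x) ≡ 0 + 𝟙 (suc (suc x) ≟ p) + 𝟙 (p ∣? cyclo₃ (suc x))
      fixed-inner inner = begin
        𝟙 (σ (suc x) ≟ suc x)
          ≡⟨ 𝟙-⇔ fixed⇒root root⇒fixed (σ (suc x) ≟ suc x) (p ∣? cyclo₃ (suc x)) ⟩
        𝟙 (p ∣? cyclo₃ (suc x))
          ≡⟨ cong (_+ 𝟙 (p ∣? cyclo₃ (suc x))) (𝟙-no (<⇒≢ (proj₂ inner)) (suc (suc x) ≟ p)) ⟨
        0 + 𝟙 (suc (suc x) ≟ p) + 𝟙 (p ∣? cyclo₃ (suc x)) ∎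
        where
        fixed⇒root : σ (suc x) ≡ suc x → p ∣ cyclo₃ (suc x)
        fixed⇒root fixed = subst (p ∣_) (sym (cyclo₃≡x*[1+x]+1 (suc x)))
                                 (subst (λ y → p ∣ y * suc (suc x) + 1) fixed (proj₂ (σ-inner inner)))
        root⇒fixed : p ∣ cyclo₃ (suc x) → σ (suc x) ≡ suc x
        root⇒fixed root = σ-unique inner 1+x<p (subst (p ∣_) (cyclo₃≡x*[1+x]+1 (suc x)) root)
      fixed-outer : ¬ Inner (suc x) → 𝟙 (σ (suc x) ≟ suc x) ≡ 0 + 𝟙 (suc (suc x) ≟ p) + 𝟙 (p ∣? cyclo₃ (suc x))
      fixed-outer outer = begin
        𝟙 (σ (suc x) ≟ suc x)
          ≡⟨ 𝟙-yes (σ-outer outer) (σ (suc x) ≟ suc x) ⟩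
        1
          ≡⟨ cong₂ _+_ (𝟙-yes 2+x≡p (suc (suc x) ≟ p)) (𝟙-no not-root (p ∣? cyclo₃ (suc x))) ⟨
        0 + 𝟙 (suc (suc x) ≟ p) + 𝟙 (p ∣? cyclo₃ (suc x)) ∎
        where
        2+x≡p : suc (suc x) ≡ p
        2+x≡p = ≤-antisym 1+x<p (≮⇒≥ (λ 2+x<p → outer (z<s , 2+x<p)))
        not-root : ¬ p ∣ cyclo₃ (suc x)
        not-root root = p∤1 (∣m+n∣m⇒∣n (subst (λ q → p ∣ suc x * q + 1) 2+x≡p (subst (p ∣_) (cyclo₃≡x*[1+x]+1 (suc x)) root))
                                        (n∣m*n (suc x)))

    pred[p]<p : pred p < p
    pred[p]<p = subst (pred p <_) (suc-pred p) (n<1+n (pred p))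

  #σ-fixed : ∑[ x < p ] 𝟙 (σ x ≟ x) ≡ 2 + #cyclo₃-roots p
  #σ-fixed = begin
    ∑[ x < p ] 𝟙 (σ x ≟ x)
      ≡⟨ ∑-cong p 𝟙-σ-fixed ⟩
    ∑[ x < p ] (𝟙 (x ≟ 0) + 𝟙 (suc x ≟ p) + 𝟙 (p ∣? cyclo₃ x))
      ≡⟨ ∑-distrib-+ p _ _ ⟩
    ∑[ x < p ] (𝟙 (x ≟ 0) + 𝟙 (suc x ≟ p)) + #cyclo₃-roots p
      ≡⟨ cong (_+ #cyclo₃-roots p) (∑-distrib-+ p _ _) ⟩
    ∑[ x < p ] 𝟙 (x ≟ 0) + ∑[ x < p ] 𝟙 (suc x ≟ p) + #cyclo₃-roots p
      ≡⟨ cong₂ (λ u v → u + v + #cyclo₃-roots p)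
               (∑-𝟙-unique p (_≟ 0) (>-nonZero⁻¹ p) (λ _ x≡0 → x≡0) refl)
               (∑-𝟙-unique p (λ x → suc x ≟ p) pred[p]<p (λ _ 1+x≡p → cong pred 1+x≡p) (suc-pred p)) ⟩
    2 + #cyclo₃-roots p
      ∎

  private
    -- (y² + y + 1) − (x₀² + x₀ + 1) = (y − x₀)(y + x₀ + 1).
    roots-of-cyclo₃ : ∀ {x₀ y} → x₀ < p → y < p → p ∣ cyclo₃ x₀ → p ∣ cyclo₃ y →
                      y ≡ x₀ ⊎ y ≡ p ∸ suc x₀
    roots-of-cyclo₃ {x₀} {y} x₀<p y<p root₀ root with p ∣? y + suc x₀
    ... | no p∤w  = inj₁ (affine-injective 0 (prime∤⇒coprime p-prime p∤w) y<p x₀<p (begin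
      (y * w + 0) % p           ≡⟨ cong (_% p) (+-identityʳ (y * w)) ⟩
      (y * w) % p               ≡⟨ %-remove-+ʳ (y * w) root₀ ⟨
      (y * w + cyclo₃ x₀) % p   ≡⟨ cong (_% p) (identity y x₀) ⟩
      (x₀ * w + cyclo₃ y) % p   ≡⟨ %-remove-+ʳ (x₀ * w) root ⟩
      (x₀ * w) % p              ≡⟨ cong (_% p) (+-identityʳ (x₀ * w)) ⟨
      (x₀ * w + 0) % p          ∎))
      where
      w : ℕ
      w = y + suc x₀
      identity : ∀ y x₀ → y * (y + suc x₀) + (x₀ * x₀ + x₀ + 1) ≡ x₀ * (y + suc x₀) + (y * y + y + 1)
      identity = solve-∀
    ... | yes p∣w = inj₂ (trans (sym (m+n∸n≡m y (suc x₀))) (cong (_∸ suc x₀) (w≡p p∣w)))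
      where
      w<p+p : y + suc x₀ < p + p
      w<p+p = +-mono-<-≤ y<p x₀<p
      w≡p : p ∣ y + suc x₀ → y + suc x₀ ≡ p
      w≡p (divides zero           w≡0)    = contradiction (trans (sym (+-suc y x₀)) w≡0) (λ ())
      w≡p (divides (suc zero)     w≡p+0)  = trans w≡p+0 (+-identityʳ p)
      w≡p (divides (suc (suc q)) w≡2p+qp) =
        contradiction (subst (_< p + p) w≡2p+qp w<p+p) (≤⇒≯ (+-monoʳ-≤ p (m≤m+n p (q * p))))

  #cyclo₃-roots≤2 : #cyclo₃-roots p ≤ 2
  #cyclo₃-roots≤2 with Fin.any? (λ (x : Fin p) → p ∣? cyclo₃ (toℕ x))
  ... | no no-root = ≤-trans (≤-reflexive (∑-zero p (λ {x} x<p → 𝟙-no (λ root → no-root (fromℕ< x<p ,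
                       subst (λ z → p ∣ cyclo₃ z) (sym (Fin.toℕ-fromℕ< x<p)) root)) (p ∣? cyclo₃ x)))) z≤n
  ... | yes (i , root₀) = ≤-trans
    (∑-mono-≤ p (λ {y} y<p → 𝟙-≤-+ (roots-of-cyclo₃ x₀<p y<p root₀) (p ∣? cyclo₃ y) (y ≟ x₀) (y ≟ x₁)))
    (≤-reflexive (begin
      ∑[ y < p ] (𝟙 (y ≟ x₀) + 𝟙 (y ≟ x₁))
        ≡⟨ ∑-distrib-+ p _ _ ⟩
      ∑[ y < p ] 𝟙 (y ≟ x₀) + ∑[ y < p ] 𝟙 (y ≟ x₁)
        ≡⟨ cong₂ _+_ (∑-𝟙-unique p (_≟ x₀) x₀<p (λ _ eq → eq) refl)
                   (∑-𝟙-unique p (_≟ x₁) x₁<p (λ _ eq → eq) refl) ⟩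
      2 ∎))
    where
    x₀ x₁ : ℕ
    x₀ = toℕ i
    x₁ = p ∸ suc x₀
    x₀<p : x₀ < p
    x₀<p = Fin.toℕ<n i
    x₁<p : x₁ < p
    x₁<p = ∸-monoʳ-< {o = 0} z<s x₀<p

  private
    p≡2+#roots[mod3] : p % 3 ≡ (2 + #cyclo₃-roots p) % 3
    p≡2+#roots[mod3] = begin
      p % 3                        ≡⟨ cong (_% 3) orbit-count ⟨
      (2 + r + 3 * k) % 3          ≡⟨ cong (λ t → (2 + r + t) % 3) (*-comm 3 k) ⟩
      (2 + r + k * 3) % 3          ≡⟨ [m+kn]%n≡m%n (2 + r) k 3 ⟩
      (2 + r) % 3                  ∎
      where
      r k : ℕ
      r = #cyclo₃-roots p
      k = ∑[ x < p ] orbitLeader σ x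
      orbit-count : 2 + r + 3 * k ≡ p
      orbit-count = trans (cong (_+ 3 * k) (sym #σ-fixed)) (fixedPoints+3*orbits≡n p σ σ-maps σ³≡id)

    h-by-residue : ∀ r → r ≤ 2 → p % 3 ≡ (2 + r) % 3 → h p ℤ.+ + r ≡ + suc p
    h-by-residue 0 _ p%3≡2 = begin
      h p ℤ.+ + 0           ≡⟨ cong (ℤ._+ + 0) (h≡ p%3≡2) ⟩
      + (p + 1 + 0)         ≡⟨ cong +_ (trans (+-identityʳ (p + 1)) (+-comm p 1)) ⟩
      + suc p               ∎
      where
      h≡ : p % 3 ≡ 2 → h p ≡ + p ℤ.+ + 1
      h≡ eq rewrite eq = refl
    h-by-residue 1 _ p%3≡0 = subst (λ q → h q ℤ.+ + 1 ≡ + suc q) (sym p≡3) refl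
      where
      p≡3 : p ≡ 3
      p≡3 with prime⇒irreducible p-prime (m%n≡0⇒n∣m p 3 p%3≡0)
      ... | inj₂ 3≡p = sym 3≡p
    h-by-residue 2 _ p%3≡1 = begin
      h p ℤ.+ + 2           ≡⟨ cong (ℤ._+ + 2) (h≡ p%3≡1) ⟩
      (+ p ℤ.- + 1) ℤ.+ + 2 ≡⟨ p-1+2≡1+p p 1<p ⟩
      + suc p               ∎
      where
      h≡ : p % 3 ≡ 1 → h p ≡ + p ℤ.- + 1
      h≡ eq rewrite eq = refl
      p-1+2≡1+p : ∀ q → 1 < q → (+ q ℤ.- + 1) ℤ.+ + 2 ≡ + suc q
      p-1+2≡1+p (suc q) _ = cong +_ (+-comm q 2)
    h-by-residue (suc (suc (suc _))) (s≤s (s≤s ())) _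

  h+#cyclo₃-roots≡1+p : h p ℤ.+ + #cyclo₃-roots p ≡ + suc p
  h+#cyclo₃-roots≡1+p = h-by-residue (#cyclo₃-roots p) #cyclo₃-roots≤2 p≡2+#roots[mod3]

-- Admissible triples modulo a prime

e₂ : ℕ → ℕ → ℕ → ℕ
e₂ a b c = a * b + b * c + c * a

eisensteinNorm : ℕ → ℕ → ℕ
eisensteinNorm a b = a * a + a * b + b * b

module _ {p : ℕ} (p-prime : Prime p) where

  private
    instance
      p≢0 : NonZero p
      p≢0 = prime⇒nonZero p-prime

    p∤1 : ¬ p ∣ 1
    p∤1 = prime∤1 p-prime

    p∤* : ∀ {x y} → ¬ p ∣ x → ¬ p ∣ y → ¬ p ∣ x * y
    p∤* = prime∤* p-prime

  unit nonunit : ℕ → ℕ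
  unit x    = 𝟙 (¬? (p ∣? x))
  nonunit x = 𝟙 (p ∣? x)

  private
    unit+nonunit≡1 : ∀ x → unit x + nonunit x ≡ 1
    unit+nonunit≡1 x = trans (+-comm (unit x) (nonunit x)) (𝟙-+-𝟙-¬ (p ∣? x))

    unit-* : ∀ x y → unit (x * y) ≡ unit x * unit y
    unit-* x y = trans (𝟙-⇔ (λ p∤xy → (λ p∣x → p∤xy (∣m⇒∣m*n y p∣x)) , (λ p∣y → p∤xy (∣n⇒∣m*n x p∣y)))
                            (λ (p∤x , p∤y) → p∤* p∤x p∤y)
                            (¬? (p ∣? x * y)) (¬? (p ∣? x) ×-dec ¬? (p ∣? y)))
                       (𝟙-× (¬? (p ∣? x)) (¬? (p ∣? y)))

    ∑-nonunit-affine : ∀ {k} l {f : ℕ → ℕ} → ¬ p ∣ k → (∀ x → f x ≡ x * k + l) →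
                       ∑[ x < p ] nonunit (f x) ≡ 1
    ∑-nonunit-affine l p∤k f≡ =
      trans (∑-cong p (λ {x} _ → cong nonunit (f≡ x))) (∑-𝟙-∣-affine l (prime∤⇒coprime p-prime p∤k))

    #nonunits : ∑[ x < p ] nonunit x ≡ 1
    #nonunits = ∑-nonunit-affine 0 p∤1 (λ x → x≡x*1+0 x)
      where
      x≡x*1+0 : ∀ x → x ≡ x * 1 + 0
      x≡x*1+0 = solve-∀

    #units : ∑[ x < p ] unit x + 1 ≡ p
    #units = begin
      ∑[ x < p ] unit x + 1                     ≡⟨ cong (_+_ (∑[ x < p ] unit x)) #nonunits ⟨
      ∑[ x < p ] unit x + ∑[ x < p ] nonunit x  ≡⟨ ∑-distrib-+ p unit nonunit ⟨
      ∑[ x < p ] (unit x + nonunit x)           ≡⟨ ∑-cong p (λ {x} _ → unit+nonunit≡1 x) ⟩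
      ∑[ x < p ] 1                              ≡⟨ trans (∑-const p 1) (*-identityʳ p) ⟩
      p                                         ∎

  χ-prime : ∀ a b c → χ p a b c ≡ unit a * (unit b * (unit c * (unit (a + b + c) * unit (e₂ a b c))))
  χ-prime a b c = begin
    χ p a b c
      ≡⟨ 𝟙-⇔ coprime⇒p∤ p∤⇒coprime (gcd x p ≟ 1) (¬? (p ∣? x)) ⟩
    unit ((a + b + c) * e₂ a b c * (a * b * c))
      ≡⟨ unit-* ((a + b + c) * e₂ a b c) (a * b * c) ⟩
    unit ((a + b + c) * e₂ a b c) * unit (a * b * c)
      ≡⟨ cong₂ _*_ (unit-* (a + b + c) (e₂ a b c)) (trans (unit-* (a * b) c) (cong (_* unit c) (unit-* a b))) ⟩
    unit (a + b + c) * unit (e₂ a b c) * (unit a * unit b * unit c)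
      ≡⟨ rearrange (unit (a + b + c)) (unit (e₂ a b c)) (unit a) (unit b) (unit c) ⟩
    unit a * (unit b * (unit c * (unit (a + b + c) * unit (e₂ a b c)))) ∎
    where
    x : ℕ
    x = poly (a , b , c)
    coprime⇒p∤ : gcd x p ≡ 1 → ¬ p ∣ x
    coprime⇒p∤ eq p∣x = p∤1 (subst (p ∣_) (gcd≡1⇒coprime {x} {p} eq (p∣x , ∣-refl)) ∣-refl)
    p∤⇒coprime : ¬ p ∣ x → gcd x p ≡ 1
    p∤⇒coprime p∤x = coprime⇒gcd≡1 (Coprimality.sym (prime∤⇒coprime p-prime p∤x))
    rearrange : ∀ s e u v w → s * e * (u * v * w) ≡ u * (v * (w * (s * e)))
    rearrange = solve-∀

  χᶜ : ℕ → ℕ → ℕ → ℕ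
  χᶜ a b c = unit c * (unit (a + b + c) * unit (e₂ a b c))

  private
    e₂≡ : ∀ a b c → a * b + b * c + c * a ≡ c * (a + b) + a * b
    e₂≡ = solve-∀

    a+b+c≡ : ∀ a b c → a + b + c ≡ c * 1 + (a + b)
    a+b+c≡ = solve-∀

    e₂+N≡ : ∀ a b c → a * b + b * c + c * a + (a * a + a * b + b * b) ≡ (a + b) * (a + b + c)
    e₂+N≡ = solve-∀

  module _ {a b : ℕ} (p∤a : ¬ p ∣ a) (p∤b : ¬ p ∣ b) where

    private
      p∤ab : ¬ p ∣ a * b
      p∤ab = p∤* p∤a p∤b

      p∤e₂ : ∀ {c} → p ∣ c → ¬ p ∣ e₂ a b c
      p∤e₂ {c} p∣c p∣e₂ = p∤ab (∣m+n∣m⇒∣n (subst (p ∣_) (e₂≡ a b c) p∣e₂) (∣m⇒∣m*n (a + b) p∣c))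

    ∑χᶜ-when-p∣a+b : p ∣ a + b → ∑[ c < p ] χᶜ a b c + 1 ≡ p
    ∑χᶜ-when-p∣a+b p∣a+b = trans (cong (_+ 1) (∑-cong p (λ {c} _ → χᶜ≡unit c))) #units
      where
      χᶜ≡unit : ∀ c → χᶜ a b c ≡ unit c
      χᶜ≡unit c = begin
        unit c * (unit (a + b + c) * unit (e₂ a b c))
          ≡⟨ cong₂ (λ u v → unit c * (u * v))
              (𝟙-⇔ (λ p∤ p∣c → p∤ (∣m∣n⇒∣m+n p∣a+b p∣c)) (λ p∤c p∣ → p∤c (∣m+n∣m⇒∣n p∣ p∣a+b))
                   (¬? (p ∣? a + b + c)) (¬? (p ∣? c)))
              (𝟙-yes (λ p∣e₂ → p∤ab (∣m+n∣m⇒∣n (subst (p ∣_) (e₂≡ a b c) p∣e₂) (∣n⇒∣m*n c p∣a+b)))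
                     (¬? (p ∣? e₂ a b c))) ⟩
        unit c * (unit c * 1)
          ≡⟨ cong (unit c *_) (*-identityʳ (unit c)) ⟩
        unit c * unit c
          ≡⟨ 𝟙-idem (¬? (p ∣? c)) ⟩
        unit c ∎

    -- c must avoid 0, −(a+b) and the root of e₂ = c(a+b) + ab; only the last two can
    -- coincide, and at c = −(a+b) we have e₂ = −(a² + ab + b²).
    ∑χᶜ-when-p∤a+b : ¬ p ∣ a + b → ∑[ c < p ] χᶜ a b c + 3 ≡ p + nonunit (eisensteinNorm a b)
    ∑χᶜ-when-p∤a+b p∤a+b = begin
      ∑[ c < p ] χᶜ a b c + 3
        ≡⟨ x+1+1+1≡x+3 (∑[ c < p ] χᶜ a b c) ⟨
      ∑[ c < p ] χᶜ a b c + 1 + 1 + 1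
        ≡⟨ cong₂ (λ u v → ∑[ c < p ] χᶜ a b c + u + v + 1) #nonunits #a+b+c ⟨
      ∑[ c < p ] χᶜ a b c + ∑[ c < p ] nonunit c + ∑[ c < p ] nonunit (a + b + c) + 1
        ≡⟨ cong (_+_ (∑[ c < p ] χᶜ a b c + ∑[ c < p ] nonunit c + ∑[ c < p ] nonunit (a + b + c))) #e₂ ⟨
      ∑[ c < p ] χᶜ a b c + ∑[ c < p ] nonunit c + ∑[ c < p ] nonunit (a + b + c) + ∑[ c < p ] nonunit (e₂ a b c)
        ≡⟨ trans (∑-distrib-+ p _ _) (cong (_+ ∑[ c < p ] nonunit (e₂ a b c))
             (trans (∑-distrib-+ p _ _) (cong (_+ ∑[ c < p ] nonunit (a + b + c)) (∑-distrib-+ p _ _)))) ⟨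
      ∑[ c < p ] (χᶜ a b c + nonunit c + nonunit (a + b + c) + nonunit (e₂ a b c))
        ≡⟨ ∑-cong p (λ {c} _ → 𝟙-inclusion-exclusion
             (λ p∣c p∣a+b+c → p∤a+b (∣m+n∣m⇒∣n (subst (p ∣_) (+-comm (a + b) c) p∣a+b+c) p∣c)) p∤e₂
             (p ∣? c) (p ∣? a + b + c) (p ∣? e₂ a b c)) ⟩
      ∑[ c < p ] (1 + nonunit (a + b + c) * nonunit (e₂ a b c))
        ≡⟨ ∑-distrib-+ p _ _ ⟩
      ∑[ c < p ] 1 + ∑[ c < p ] (nonunit (a + b + c) * nonunit (e₂ a b c))
        ≡⟨ cong₂ _+_ (trans (∑-const p 1) (*-identityʳ p)) (∑-cong p (λ {c} _ → e₂-on-the-line c)) ⟩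
      p + ∑[ c < p ] (nonunit (a + b + c) * nonunit (eisensteinNorm a b))
        ≡⟨ cong (_+_ p) (trans (∑-*ʳ p _ _) (cong (_* nonunit (eisensteinNorm a b)) #a+b+c)) ⟩
      p + 1 * nonunit (eisensteinNorm a b)
        ≡⟨ cong (_+_ p) (*-identityˡ _) ⟩
      p + nonunit (eisensteinNorm a b)
        ∎
      where
      #a+b+c : ∑[ c < p ] nonunit (a + b + c) ≡ 1
      #a+b+c = ∑-nonunit-affine (a + b) p∤1 (a+b+c≡ a b)
      #e₂ : ∑[ c < p ] nonunit (e₂ a b c) ≡ 1
      #e₂ = ∑-nonunit-affine (a * b) p∤a+b (e₂≡ a b)
      x+1+1+1≡x+3 : ∀ x → x + 1 + 1 + 1 ≡ x + 3
      x+1+1+1≡x+3 = solve-∀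
      e₂-on-the-line : ∀ c → nonunit (a + b + c) * nonunit (e₂ a b c) ≡ nonunit (a + b + c) * nonunit (eisensteinNorm a b)
      e₂-on-the-line c with p ∣? a + b + c
      ... | no _       = refl
      ... | yes p∣a+b+c = cong (1 *_) (𝟙-⇔ (λ p∣e₂ → ∣m+n∣m⇒∣n p∣e₂+N p∣e₂)
                                          (λ p∣N → ∣m+n∣m⇒∣n (subst (p ∣_) (+-comm (e₂ a b c) (eisensteinNorm a b)) p∣e₂+N) p∣N)
                                          (p ∣? e₂ a b c) (p ∣? eisensteinNorm a b))
        where
        p∣e₂+N : p ∣ e₂ a b c + eisensteinNorm a b
        p∣e₂+N = subst (p ∣_) (sym (e₂+N≡ a b c)) (∣n⇒∣m*n (a + b) p∣a+b+c)

  private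
    N≡ : ∀ a b → a * a + a * b + b * b ≡ b * (a + b) + a * a
    N≡ = solve-∀

    N+ab≡ : ∀ a b → a * a + a * b + b * b + a * b ≡ (a + b) * (a + b)
    N+ab≡ = solve-∀

  module _ {a : ℕ} (p∤a : ¬ p ∣ a) where

    private
      unit-a≡1 : unit a ≡ 1
      unit-a≡1 = 𝟙-yes p∤a (¬? (p ∣? a))

      ∑χ≡unit*∑χᶜ : ∀ b → ∑[ c < p ] χ p a b c ≡ unit b * ∑[ c < p ] χᶜ a b c
      ∑χ≡unit*∑χᶜ b = begin
        ∑[ c < p ] χ p a b c
          ≡⟨ ∑-cong p (λ {c} _ → trans (χ-prime a b c) (cong (_* (unit b * χᶜ a b c)) unit-a≡1)) ⟩
        ∑[ c < p ] (1 * (unit b * χᶜ a b c))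
          ≡⟨ ∑-cong p (λ {c} _ → *-identityˡ (unit b * χᶜ a b c)) ⟩
        ∑[ c < p ] (unit b * χᶜ a b c)
          ≡⟨ ∑-*ˡ p (unit b) (χᶜ a b) ⟩
        unit b * ∑[ c < p ] χᶜ a b c ∎

      -- One equation for the three cases p ∣ b, p ∣ a + b and neither, each term placed
      -- on the side where no subtraction is needed.
      ∑χ-over-c : ∀ b → ∑[ c < p ] χ p a b c + 3 * (unit b * unit (a + b)) + unit b * nonunit (a + b)
                      ≡ p * unit b + nonunit (eisensteinNorm a b)
      ∑χ-over-c b = begin
        ∑[ c < p ] χ p a b c + 3 * (unit b * unit (a + b)) + unit b * nonunit (a + b)
          ≡⟨ cong (λ u → u + 3 * (unit b * unit (a + b)) + unit b * nonunit (a + b)) (∑χ≡unit*∑χᶜ b) ⟩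
        unit b * S + 3 * (unit b * unit (a + b)) + unit b * nonunit (a + b)
          ≡⟨ by-cases (p ∣? b) (p ∣? a + b) ⟩
        p * unit b + nonunit (eisensteinNorm a b)
          ∎
        where
        S N : ℕ
        S = ∑[ c < p ] χᶜ a b c
        N = eisensteinNorm a b
        by-cases : Dec (p ∣ b) → Dec (p ∣ a + b) →
                   unit b * S + 3 * (unit b * unit (a + b)) + unit b * nonunit (a + b) ≡ p * unit b + nonunit N
        by-cases (yes p∣b) _ = begin
          unit b * S + 3 * (unit b * unit (a + b)) + unit b * nonunit (a + b)
            ≡⟨ cong (λ u → u * S + 3 * (u * unit (a + b)) + u * nonunit (a + b)) unit-b≡0 ⟩
          0
            ≡⟨ trans (+-identityʳ (p * 0)) (*-zeroʳ p) ⟨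
          p * 0 + 0
            ≡⟨ cong₂ (λ u v → p * u + v) unit-b≡0 N-unit ⟨
          p * unit b + nonunit N
            ∎
          where
          unit-b≡0 : unit b ≡ 0
          unit-b≡0 = 𝟙-no (λ p∤b → p∤b p∣b) (¬? (p ∣? b))
          N-unit : nonunit N ≡ 0
          N-unit = 𝟙-no (λ p∣N → p∤* p∤a p∤a (∣m+n∣m⇒∣n (subst (p ∣_) (N≡ a b) p∣N) (∣m⇒∣m*n (a + b) p∣b))) (p ∣? N)
        by-cases (no p∤b) (yes p∣a+b) = begin
          unit b * S + 3 * (unit b * unit (a + b)) + unit b * nonunit (a + b)
            ≡⟨ cong₂ (λ u v → u * S + 3 * (u * v) + u * nonunit (a + b)) unit-b≡1 (𝟙-no (λ p∤ → p∤ p∣a+b) (¬? (p ∣? a + b))) ⟩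
          1 * S + 0 + 1 * nonunit (a + b)
            ≡⟨ cong₂ (λ u v → u + 0 + 1 * v) (*-identityˡ S) (𝟙-yes p∣a+b (p ∣? a + b)) ⟩
          S + 0 + 1
            ≡⟨ cong (_+ 1) (+-identityʳ S) ⟩
          S + 1
            ≡⟨ ∑χᶜ-when-p∣a+b p∤a p∤b p∣a+b ⟩
          p
            ≡⟨ trans (+-identityʳ (p * 1)) (*-identityʳ p) ⟨
          p * 1 + 0
            ≡⟨ cong₂ (λ u v → p * u + v) unit-b≡1 N-unit ⟨
          p * unit b + nonunit N
            ∎
          where
          unit-b≡1 : unit b ≡ 1
          unit-b≡1 = 𝟙-yes p∤b (¬? (p ∣? b))
          N-unit : nonunit N ≡ 0
          N-unit = 𝟙-no (λ p∣N → p∤* p∤a p∤b (∣m+n∣m⇒∣n (subst (p ∣_) (sym (N+ab≡ a b)) (∣m⇒∣m*n (a + b) p∣a+b)) p∣N)) (p ∣? N)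
        by-cases (no p∤b) (no p∤a+b) = begin
          unit b * S + 3 * (unit b * unit (a + b)) + unit b * nonunit (a + b)
            ≡⟨ cong₂ (λ u v → u * S + 3 * (u * v) + u * nonunit (a + b)) unit-b≡1 (𝟙-yes p∤a+b (¬? (p ∣? a + b))) ⟩
          1 * S + 3 + 1 * nonunit (a + b)
            ≡⟨ cong₂ (λ u v → u + 3 + 1 * v) (*-identityˡ S) (𝟙-no p∤a+b (p ∣? a + b)) ⟩
          S + 3 + 0
            ≡⟨ +-identityʳ (S + 3) ⟩
          S + 3
            ≡⟨ ∑χᶜ-when-p∤a+b p∤a p∤b p∤a+b ⟩
          p + nonunit N
            ≡⟨ cong (_+ nonunit N) (*-identityʳ p) ⟨
          p * 1 + nonunit N
            ≡⟨ cong (λ u → p * u + nonunit N) unit-b≡1 ⟨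
          p * unit b + nonunit N
            ∎
          where
          unit-b≡1 : unit b ≡ 1
          unit-b≡1 = 𝟙-yes p∤b (¬? (p ∣? b))

      ∑unit*nonunit[a+b]≡1 : ∑[ b < p ] (unit b * nonunit (a + b)) ≡ 1
      ∑unit*nonunit[a+b]≡1 = begin
        ∑[ b < p ] (unit b * nonunit (a + b))
          ≡⟨ ∑-cong p (λ {b} _ → 𝟙-¬-absorb (λ p∣a+b p∣b → p∤a (∣m+n∣m⇒∣n (subst (p ∣_) (+-comm a b) p∣a+b) p∣b))
                                         (p ∣? b) (p ∣? a + b)) ⟩
        ∑[ b < p ] nonunit (a + b)
          ≡⟨ ∑-nonunit-affine a p∤1 (λ b → a+b≡b*1+a b) ⟩
        1 ∎
        where
        a+b≡b*1+a : ∀ b → a + b ≡ b * 1 + a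
        a+b≡b*1+a b = trans (+-comm a b) (cong (_+ a) (sym (*-identityʳ b)))

      #units≡s+1 : ∑[ b < p ] unit b ≡ ∑[ b < p ] (unit b * unit (a + b)) + 1
      #units≡s+1 = begin
        ∑[ b < p ] unit b
          ≡⟨ ∑-cong p (λ {b} _ → split b) ⟩
        ∑[ b < p ] (unit b * unit (a + b) + unit b * nonunit (a + b))
          ≡⟨ ∑-distrib-+ p _ _ ⟩
        ∑[ b < p ] (unit b * unit (a + b)) + ∑[ b < p ] (unit b * nonunit (a + b))
          ≡⟨ cong (_+_ (∑[ b < p ] (unit b * unit (a + b)))) ∑unit*nonunit[a+b]≡1 ⟩
        ∑[ b < p ] (unit b * unit (a + b)) + 1 ∎
        where
        split : ∀ b → unit b ≡ unit b * unit (a + b) + unit b * nonunit (a + b)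
        split b = begin
          unit b
            ≡⟨ *-identityʳ (unit b) ⟨
          unit b * 1
            ≡⟨ cong (unit b *_) (unit+nonunit≡1 (a + b)) ⟨
          unit b * (unit (a + b) + nonunit (a + b))
            ≡⟨ *-distribˡ-+ (unit b) (unit (a + b)) (nonunit (a + b)) ⟩
          unit b * unit (a + b) + unit b * nonunit (a + b) ∎

      -- b = xa turns a² + ab + b² into a²(x² + x + 1).
      ∑nonunit-N≡#roots : ∑[ b < p ] nonunit (eisensteinNorm a b) ≡ #cyclo₃-roots p
      ∑nonunit-N≡#roots = begin
        ∑[ b < p ] nonunit (eisensteinNorm a b)
          ≡⟨ ∑-permute p (λ b → nonunit (eisensteinNorm a b)) (λ {x} _ → m%n<n (x * a + 0) p)
                         (affine-injective 0 p⊥a) ⟨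
        ∑[ x < p ] nonunit (eisensteinNorm a ((x * a + 0) % p)) ≡⟨ ∑-cong p (λ {x} _ → nonunit-N-% (x * a + 0)) ⟩
        ∑[ x < p ] nonunit (eisensteinNorm a (x * a + 0))
          ≡⟨ ∑-cong p (λ {x} _ → trans (cong nonunit (scale a x)) (nonunit-unit* (cyclo₃ x))) ⟩
        #cyclo₃-roots p ∎
        where
        p⊥a : Coprime p a
        p⊥a = prime∤⇒coprime p-prime p∤a
        scale : ∀ a x → a * a + a * (x * a + 0) + (x * a + 0) * (x * a + 0) ≡ a * a * (x * x + x + 1)
        scale = solve-∀
        nonunit-unit* : ∀ y → nonunit (a * a * y) ≡ nonunit y
        nonunit-unit* y = 𝟙-⇔
          (λ p∣a²y → [ (λ p∣a² → contradiction p∣a² (p∤* p∤a p∤a)) , (λ p∣y → p∣y) ]′ (euclidsLemma (a * a) y p-prime p∣a²y))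
                             (∣n⇒∣m*n (a * a)) (p ∣? a * a * y) (p ∣? y)
        nonunit-N-% : ∀ y → nonunit (eisensteinNorm a (y % p)) ≡ nonunit (eisensteinNorm a y)
        nonunit-N-% y = 𝟙-⇔ (∣-resp-≡[mod] ∣-refl N%≡N) (∣-resp-≡[mod] ∣-refl (sym N%≡N))
                            (p ∣? eisensteinNorm a (y % p)) (p ∣? eisensteinNorm a y)
          where
          y%≡y : y % p ≡ y [mod p ]
          y%≡y = %-≡[mod] y
          N%≡N : eisensteinNorm a (y % p) ≡ eisensteinNorm a y [mod p ]
          N%≡N = +-cong-mod {n = p} (+-cong-mod {n = p} {a = a * a} refl (*-cong-mod {n = p} {a = a} refl y%≡y))
                                    (*-cong-mod {n = p} y%≡y y%≡y)

    ∑χ-over-bc : ∑[ b < p ] ∑[ c < p ] χ p a b c ≡ (p ∸ 2) * (p ∸ 2) + 1 + #cyclo₃-roots p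
    ∑χ-over-bc = begin
      #bc                        ≡⟨ +-cancelʳ-≡ (3 * s + 1) #bc (s * s + 1 + r) (begin
        #bc + (3 * s + 1)             ≡⟨ +-assoc #bc (3 * s) 1 ⟨
        #bc + 3 * s + 1               ≡⟨ summed ⟩
        p * t + r                   ≡⟨ cong₂ (λ u v → u * v + r) p≡s+2 #units≡s+1 ⟩
        (s + 2) * (s + 1) + r       ≡⟨ arithmetic s r ⟩
        s * s + 1 + r + (3 * s + 1) ∎) ⟩
      s * s + 1 + r            ≡⟨ cong (λ u → u * u + 1 + r) (trans (cong (_∸ 2) p≡s+2) (m+n∸n≡m s 2)) ⟨
      (p ∸ 2) * (p ∸ 2) + 1 + r ∎
      where
      #bc s t r : ℕ
      #bc = ∑[ b < p ] ∑[ c < p ] χ p a b c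
      s = ∑[ b < p ] (unit b * unit (a + b))
      t = ∑[ b < p ] unit b
      r = #cyclo₃-roots p
      p≡s+2 : p ≡ s + 2
      p≡s+2 = trans (sym #units) (trans (cong (_+ 1) #units≡s+1) (+-assoc s 1 1))
      arithmetic : ∀ s r → (s + 2) * (s + 1) + r ≡ s * s + 1 + r + (3 * s + 1)
      arithmetic = solve-∀
      summed : #bc + 3 * s + 1 ≡ p * t + r
      summed = begin
        #bc + 3 * s + 1
          ≡⟨ cong₂ (λ u v → #bc + u + v) (∑-*ˡ p 3 _) ∑unit*nonunit[a+b]≡1 ⟨
        #bc + ∑[ b < p ] (3 * (unit b * unit (a + b))) + ∑[ b < p ] (unit b * nonunit (a + b))
          ≡⟨ trans (∑-distrib-+ p _ _) (cong (_+ ∑[ b < p ] (unit b * nonunit (a + b))) (∑-distrib-+ p _ _)) ⟨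
        ∑[ b < p ] (∑[ c < p ] χ p a b c + 3 * (unit b * unit (a + b)) + unit b * nonunit (a + b))
          ≡⟨ ∑-cong p (λ {b} _ → ∑χ-over-c b) ⟩
        ∑[ b < p ] (p * unit b + nonunit (eisensteinNorm a b))
          ≡⟨ ∑-distrib-+ p _ _ ⟩
        ∑[ b < p ] (p * unit b) + ∑[ b < p ] nonunit (eisensteinNorm a b)
          ≡⟨ cong₂ _+_ (∑-*ˡ p p unit) ∑nonunit-N≡#roots ⟩
        p * t + r
          ∎

  Φ-prime : Φ p ≡ (p ∸ 1) * ((p ∸ 2) * (p ∸ 2) + 1 + #cyclo₃-roots p)
  Φ-prime = begin
    Φ p
      ≡⟨ ∑-cong p (λ {a} _ → ∑χ-over-bc′ a) ⟩
    ∑[ a < p ] (unit a * V) ≡⟨ ∑-*ʳ p V unit ⟩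
    ∑[ a < p ] unit a * V
      ≡⟨ cong (_* V) (trans (sym (m+n∸n≡m (∑[ a < p ] unit a) 1)) (cong (_∸ 1) #units)) ⟩
    (p ∸ 1) * V ∎
    where
    V : ℕ
    V = (p ∸ 2) * (p ∸ 2) + 1 + #cyclo₃-roots p
    ∑χ-over-bc′ : ∀ a → ∑[ b < p ] ∑[ c < p ] χ p a b c ≡ unit a * V
    ∑χ-over-bc′ a = by-cases (p ∣? a)
      where
      by-cases : Dec (p ∣ a) → ∑[ b < p ] ∑[ c < p ] χ p a b c ≡ unit a * V
      by-cases (no p∤a)  = trans (∑χ-over-bc p∤a) (sym (trans (cong (_* V) (𝟙-yes p∤a (¬? (p ∣? a)))) (*-identityˡ V)))
      by-cases (yes p∣a) = trans (∑-zero p (λ {b} _ → ∑-zero p (λ {c} _ →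
                                   trans (χ-prime a b c) (cong (_* (unit b * χᶜ a b c)) unit-a≡0))))
                                 (sym (cong (_* V) unit-a≡0))
        where
        unit-a≡0 : unit a ≡ 0
        unit-a≡0 = 𝟙-no (λ p∤a → p∤a p∣a) (¬? (p ∣? a))

-- Products over prime divisors

∏< : ℕ → (ℕ → ℚ) → ℚ
∏< zero    f = 1ℚ
∏< (suc n) f = f 0 ℚ.* ∏< n (λ i → f (suc i))

syntax ∏< n (λ i → e) = ∏[ i < n ] e

∏-cong : ∀ n {f g : ℕ → ℚ} → (∀ {i} → i < n → f i ≡ g i) → ∏< n f ≡ ∏< n g
∏-cong zero    f≗g = refl
∏-cong (suc n) f≗g = cong₂ ℚ._*_ (f≗g (s≤s z≤n)) (∏-cong n (λ i<n → f≗g (s≤s i<n)))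

∏-one : ∀ n {f : ℕ → ℚ} → (∀ {i} → i < n → f i ≡ 1ℚ) → ∏< n f ≡ 1ℚ
∏-one zero    f≗1 = refl
∏-one (suc n) f≗1 = cong₂ ℚ._*_ (f≗1 (s≤s z≤n)) (∏-one n (λ i<n → f≗1 (s≤s i<n)))

∏-distrib-* : ∀ n (f g : ℕ → ℚ) → ∏[ i < n ] (f i ℚ.* g i) ≡ ∏< n f ℚ.* ∏< n g
∏-distrib-* zero    f g = refl
∏-distrib-* (suc n) f g = trans (cong (f 0 ℚ.* g 0 ℚ.*_) (∏-distrib-* n (λ i → f (suc i)) (λ i → g (suc i))))
                                (ℚ-*-interchange (f 0) (g 0) _ _)

∏-+ : ∀ m k (f : ℕ → ℚ) → ∏< (m + k) f ≡ ∏< m f ℚ.* ∏[ i < k ] f (m + i)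
∏-+ zero    k f = sym (ℚ.*-identityˡ _)
∏-+ (suc m) k f = trans (cong (f 0 ℚ.*_) (∏-+ m k (λ i → f (suc i)))) (sym (ℚ.*-assoc (f 0) _ _))

select : ∀ {P : Set} → Dec P → ℚ → ℚ
select (yes _) x = x
select (no _)  _ = 1ℚ

select-yes : ∀ {P : Set} {x} → P → (P? : Dec P) → select P? x ≡ x
select-yes p (yes _) = refl
select-yes p (no ¬p) = contradiction p ¬p

select-no : ∀ {P : Set} {x} → ¬ P → (P? : Dec P) → select P? x ≡ 1ℚ
select-no ¬p (yes p) = contradiction p ¬p
select-no ¬p (no _)  = refl

select-⇔ : ∀ {P Q : Set} {x} → (P → Q) → (Q → P) → (P? : Dec P) (Q? : Dec Q) → select P? x ≡ select Q? x
select-⇔ P⇒Q Q⇒P (yes p) Q? = sym (select-yes (P⇒Q p) Q?)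
select-⇔ P⇒Q Q⇒P (no ¬p) Q? = sym (select-no (λ q → ¬p (Q⇒P q)) Q?)

select-⊎ : ∀ {P Q R : Set} {x} → (P → Q ⊎ R) → (Q → P) → (R → P) → (Q → ¬ R) →
           (P? : Dec P) (Q? : Dec Q) (R? : Dec R) → select P? x ≡ select Q? x ℚ.* select R? x
select-⊎ P⇒Q⊎R Q⇒P R⇒P Q⇒¬R P? (yes q) (yes r) = contradiction r (Q⇒¬R q)
select-⊎ P⇒Q⊎R Q⇒P R⇒P Q⇒¬R P? (yes q) (no _)  = trans (select-yes (Q⇒P q) P?) (sym (ℚ.*-identityʳ _))
select-⊎ P⇒Q⊎R Q⇒P R⇒P Q⇒¬R P? (no _)  (yes r) = trans (select-yes (R⇒P r) P?) (sym (ℚ.*-identityˡ _))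
select-⊎ P⇒Q⊎R Q⇒P R⇒P Q⇒¬R P? (no ¬q) (no ¬r) = select-no (λ p → [ ¬q , ¬r ]′ (P⇒Q⊎R p)) P?

foldr-*-map-filter : ∀ {P : ℕ → Set} (P? : ∀ x → Dec (P x)) (f : ℕ → ℚ) (g : ℕ → ℕ) n →
  foldr ℚ._*_ 1ℚ (map f (filter P? (applyUpTo g n))) ≡ ∏[ i < n ] select (P? (g i)) (f (g i))
foldr-*-map-filter P? f g zero    = refl
foldr-*-map-filter P? f g (suc n) with P? (g 0)
... | yes _ = cong (f (g 0) ℚ.*_) (foldr-*-map-filter P? f (λ i → g (suc i)) n)
... | no _  = trans (foldr-*-map-filter P? f (λ i → g (suc i)) n) (sym (ℚ.*-identityˡ _))

∏-primeDivisors : (ℕ → ℚ) → ℕ → ℚ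
∏-primeDivisors f n = foldr ℚ._*_ 1ℚ (map f (primeDivisors n))

primeDivisorFactor : (ℕ → ℚ) → ℕ → ℕ → ℚ
primeDivisorFactor f n q = select (prime? q ×-dec q ∣? n) (f q)

∏-primeDivisors-range : ∀ f n .{{_ : NonZero n}} N → n < N → ∏-primeDivisors f n ≡ ∏< N (primeDivisorFactor f n)
∏-primeDivisors-range f n N n<N = begin
  ∏-primeDivisors f n
    ≡⟨ foldr-*-map-filter (λ q → prime? q ×-dec q ∣? n) f (λ q → q) (suc n) ⟩
  ∏< (suc n) F
    ≡⟨ ℚ.*-identityʳ _ ⟨
  ∏< (suc n) F ℚ.* 1ℚ
    ≡⟨ cong (∏< (suc n) F ℚ.*_) (∏-one k (λ {i} _ →
         select-no (λ (_ , q∣n) → beyond i q∣n) (prime? (suc n + i) ×-dec suc n + i ∣? n))) ⟨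
  ∏< (suc n) F ℚ.* ∏[ i < k ] F (suc n + i)
    ≡⟨ ∏-+ (suc n) k F ⟨
  ∏< (suc n + k) F
    ≡⟨ cong (λ N → ∏< N F) (m+[n∸m]≡n n<N) ⟩
  ∏< N F ∎
  where
  F : ℕ → ℚ
  F = primeDivisorFactor f n
  k : ℕ
  k = N ∸ suc n
  beyond : ∀ i → ¬ suc n + i ∣ n
  beyond i q∣n = <⇒≱ (s≤s (m≤m+n n i)) (∣⇒≤ q∣n)

prime∣prime⇒≡ : ∀ {p q} → Prime p → Prime q → q ∣ p → q ≡ p
prime∣prime⇒≡ p-prime q-prime q∣p with prime⇒irreducible p-prime q∣p
... | inj₁ refl = contradiction (1<prime q-prime) (<-irrefl refl)
... | inj₂ q≡p  = q≡p

∏-primeDivisors-prime : ∀ f {p} → Prime p → ∏-primeDivisors f p ≡ f p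
∏-primeDivisors-prime f {p} p-prime = begin
  ∏-primeDivisors f p
    ≡⟨ ∏-primeDivisors-range f p (p + 1) (m<m+n p (s≤s z≤n)) ⟩
  ∏< (p + 1) F
    ≡⟨ ∏-+ p 1 F ⟩
  ∏< p F ℚ.* (F (p + 0) ℚ.* 1ℚ)
    ≡⟨ cong₂ ℚ._*_ (∏-one p (λ {q} q<p → select-no (λ (q-prime , q∣p) → <⇒≢ q<p (prime∣prime⇒≡ p-prime q-prime q∣p))
                                       (prime? q ×-dec q ∣? p)))
             (trans (ℚ.*-identityʳ _) (cong F (+-identityʳ p))) ⟩
  1ℚ ℚ.* F p
    ≡⟨ ℚ.*-identityˡ (F p) ⟩
  F p
    ≡⟨ select-yes (p-prime , ∣-refl) (prime? p ×-dec p ∣? p) ⟩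
  f p ∎
  where
  instance
    p≢0 : NonZero p
    p≢0 = prime⇒nonZero p-prime
  F : ℕ → ℚ
  F = primeDivisorFactor f p

∏-primeDivisors-∣ : ∀ f k m .{{_ : NonZero k}} .{{_ : NonZero m}} → k ∣ m →
                    ∏-primeDivisors f (k * m) ≡ ∏-primeDivisors f m
∏-primeDivisors-∣ f k m k∣m = begin
  ∏-primeDivisors f (k * m)
    ≡⟨ ∏-primeDivisors-range f (k * m) N ≤-refl ⟩
  ∏< N (primeDivisorFactor f (k * m))
    ≡⟨ ∏-cong N (λ {q} _ → select-⇔ {x = f q}
         (λ (q-prime , q∣km) → q-prime , q∣m q-prime q∣km) (λ (q-prime , q∣m) → q-prime , ∣n⇒∣m*n k q∣m)
         (prime? q ×-dec q ∣? k * m) (prime? q ×-dec q ∣? m)) ⟩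
  ∏< N (primeDivisorFactor f m)
    ≡⟨ ∏-primeDivisors-range f m N (s≤s (m≤n*m m k)) ⟨
  ∏-primeDivisors f m ∎
  where
  instance
    km≢0 : NonZero (k * m)
    km≢0 = m*n≢0 k m
  N : ℕ
  N = suc (k * m)
  q∣m : ∀ {q} → Prime q → q ∣ k * m → q ∣ m
  q∣m q-prime q∣km with euclidsLemma k m q-prime q∣km
  ... | inj₁ q∣k = ∣-trans q∣k k∣m
  ... | inj₂ q∣m = q∣m

∏-primeDivisors-coprime : ∀ f {p} m .{{_ : NonZero m}} → Prime p → ¬ p ∣ m →
                          ∏-primeDivisors f (p * m) ≡ f p ℚ.* ∏-primeDivisors f m
∏-primeDivisors-coprime f {p} m p-prime p∤m = begin
  ∏-primeDivisors f (p * m)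
    ≡⟨ ∏-primeDivisors-range f (p * m) N ≤-refl ⟩
  ∏< N (primeDivisorFactor f (p * m))
    ≡⟨ ∏-cong N (λ {q} _ → factor-split q) ⟩
  ∏[ q < N ] (primeDivisorFactor f p q ℚ.* primeDivisorFactor f m q)
    ≡⟨ ∏-distrib-* N (primeDivisorFactor f p) (primeDivisorFactor f m) ⟩
  ∏< N (primeDivisorFactor f p) ℚ.* ∏< N (primeDivisorFactor f m)
    ≡⟨ cong₂ ℚ._*_ (∏-primeDivisors-range f p N (s≤s (m≤m*n p m)))
                 (∏-primeDivisors-range f m N (s≤s (m≤n*m m p))) ⟨
  ∏-primeDivisors f p ℚ.* ∏-primeDivisors f m
    ≡⟨ cong (ℚ._* ∏-primeDivisors f m) (∏-primeDivisors-prime f p-prime) ⟩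
  f p ℚ.* ∏-primeDivisors f m ∎
  where
  instance
    p≢0 : NonZero p
    p≢0 = prime⇒nonZero p-prime
    pm≢0 : NonZero (p * m)
    pm≢0 = m*n≢0 p m
  N : ℕ
  N = suc (p * m)
  factor-split : ∀ q → primeDivisorFactor f (p * m) q ≡ primeDivisorFactor f p q ℚ.* primeDivisorFactor f m q
  factor-split q = select-⊎ {x = f q}
    (λ (q-prime , q∣pm) → Sum.map (q-prime ,_) (q-prime ,_) (euclidsLemma p m q-prime q∣pm))
    (λ (q-prime , q∣p) → q-prime , ∣m⇒∣m*n m q∣p)
    (λ (q-prime , q∣m) → q-prime , ∣n⇒∣m*n p q∣m)
    (λ (q-prime , q∣p) (_ , q∣m) → p∤m (subst (_∣ m) (prime∣prime⇒≡ p-prime q-prime q∣p) q∣m))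
    (prime? q ×-dec q ∣? p * m) (prime? q ×-dec q ∣? p) (prime? q ×-dec q ∣? m)

-- Rational arithmetic

fromℤ : ℤ → ℚ
fromℤ i = i / 1

fromℕ : ℕ → ℚ
fromℕ n = fromℤ (+ n)

private
  toℚᵘ-/ : ∀ i n → toℚᵘ (i / suc n) ≃ mkℚᵘ i n
  toℚᵘ-/ i n = ℚ.toℚᵘ-fromℚᵘ (mkℚᵘ i n)

  via-ℚᵘ : ∀ {x y : ℚ} {a b : ℚᵘ} → toℚᵘ x ≃ a → toℚᵘ y ≃ b → a ≃ b → x ≡ y
  via-ℚᵘ x≃a y≃b a≃b = ℚ.toℚᵘ-injective (ℚᵘ.≃-trans x≃a (ℚᵘ.≃-trans a≃b (ℚᵘ.≃-sym y≃b)))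


fromℤ-* : ∀ i j → fromℤ (i ℤ.* j) ≡ fromℤ i ℚ.* fromℤ j
fromℤ-* i j = via-ℚᵘ (toℚᵘ-/ (i ℤ.* j) 0)
  (ℚᵘ.≃-trans (ℚ.toℚᵘ-homo-* (fromℤ i) (fromℤ j)) (ℚᵘ.*-cong (toℚᵘ-/ i 0) (toℚᵘ-/ j 0))) ℚᵘ.≃-refl

fromℤ-+ : ∀ i j → fromℤ (i ℤ.+ j) ≡ fromℤ i ℚ.+ fromℤ j
fromℤ-+ i j = via-ℚᵘ (toℚᵘ-/ (i ℤ.+ j) 0)
  (ℚᵘ.≃-trans (ℚ.toℚᵘ-homo-+ (fromℤ i) (fromℤ j)) (ℚᵘ.+-cong (toℚᵘ-/ i 0) (toℚᵘ-/ j 0)))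
  (*≡* (cong (ℤ._* + 1) (sym (cong₂ ℤ._+_ (ℤ.*-identityʳ i) (ℤ.*-identityʳ j)))))

fromℤ-neg : ∀ i → fromℤ (ℤ.- i) ≡ ℚ.- fromℤ i
fromℤ-neg i = via-ℚᵘ (toℚᵘ-/ (ℤ.- i) 0) (ℚᵘ.≃-trans (ℚ.toℚᵘ-homo‿- (fromℤ i)) (ℚᵘ.-‿cong (toℚᵘ-/ i 0))) ℚᵘ.≃-refl

fromℤ-- : ∀ i j → fromℤ (i ℤ.- j) ≡ fromℤ i ℚ.- fromℤ j
fromℤ-- i j = trans (fromℤ-+ i (ℤ.- j)) (cong (fromℤ i ℚ.+_) (fromℤ-neg j))

fromℕ-+ : ∀ m n → fromℕ (m + n) ≡ fromℕ m ℚ.+ fromℕ n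
fromℕ-+ m n = fromℤ-+ (+ m) (+ n)

fromℕ-* : ∀ m n → fromℕ (m * n) ≡ fromℕ m ℚ.* fromℕ n
fromℕ-* m n = trans (cong fromℤ (ℤ.pos-* m n)) (fromℤ-* (+ m) (+ n))

/≡fromℤ*1/ : ∀ i n → i / suc n ≡ fromℤ i ℚ.* (+ 1 / suc n)
/≡fromℤ*1/ i n = via-ℚᵘ (toℚᵘ-/ i n)
  (ℚᵘ.≃-trans (ℚ.toℚᵘ-homo-* (fromℤ i) (+ 1 / suc n)) (ℚᵘ.*-cong (toℚᵘ-/ i 0) (toℚᵘ-/ (+ 1) n)))
  (*≡* (subst (λ k → i ℤ.* + suc k ≡ (i ℤ.* + 1) ℤ.* + suc n) (sym (+-identityʳ n))
              (cong (ℤ._* + suc n) (sym (ℤ.*-identityʳ i)))))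

1/[m*n]≡1/m*1/n : ∀ m n → + 1 / (suc m * suc n) ≡ (+ 1 / suc m) ℚ.* (+ 1 / suc n)
1/[m*n]≡1/m*1/n m n = via-ℚᵘ (toℚᵘ-/ (+ 1) (n + m * suc n))
  (ℚᵘ.≃-trans (ℚ.toℚᵘ-homo-* (+ 1 / suc m) (+ 1 / suc n)) (ℚᵘ.*-cong (toℚᵘ-/ (+ 1) m) (toℚᵘ-/ (+ 1) n))) ℚᵘ.≃-refl

n*1/n≡1 : ∀ n → fromℕ (suc n) ℚ.* (+ 1 / suc n) ≡ 1ℚ
n*1/n≡1 n = via-ℚᵘ
  (ℚᵘ.≃-trans (ℚ.toℚᵘ-homo-* (fromℕ (suc n)) (+ 1 / suc n)) (ℚᵘ.*-cong (toℚᵘ-/ (+ suc n) 0) (toℚᵘ-/ (+ 1) n)))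
  ℚᵘ.≃-refl
  (*≡* (subst (λ k → (+ suc n ℤ.* + 1) ℤ.* + 1 ≡ + 1 ℤ.* + suc k) (sym (+-identityʳ n))
              (trans (ℤ.*-identityʳ (+ suc n ℤ.* + 1)) (trans (ℤ.*-identityʳ (+ suc n)) (sym (ℤ.*-identityˡ (+ suc n)))))))

private
  c2 c3 c6 : ℚ
  c2 = fromℤ (+ 2)
  c3 = fromℤ (+ 3)
  c6 = fromℤ (+ 6)

-- P, S, R, H, u stand for p, p − 2, r, h(p) and 1/p.
localFactor-algebra : ∀ P S R H u → P ≡ c2 ℚ.+ S → P ℚ.* u ≡ 1ℚ → H ℚ.+ R ≡ 1ℚ ℚ.+ P →
  (1ℚ ℚ.+ S) ℚ.* (S ℚ.* S ℚ.+ 1ℚ ℚ.+ R)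
    ≡ P ℚ.* P ℚ.* P ℚ.* ((1ℚ ℚ.- u) ℚ.* ((1ℚ ℚ.- c3 ℚ.* u) ℚ.+ (c6 ℚ.- H) ℚ.* (u ℚ.* u)))
localFactor-algebra P S R H u P≡2+S Pu≡1 H+R≡1+P = begin
  (1ℚ ℚ.+ S) ℚ.* (S ℚ.* S ℚ.+ 1ℚ ℚ.+ R)
    ≡⟨ solve 2 (λ S R → (con 1ℚ :+ S) :* (S :* S :+ con 1ℚ :+ R) :=
                         (con c2 :+ S :- con 1ℚ) :* ((con c2 :+ S) :* (con c2 :+ S) :- con c3 :* (con c2 :+ S) :* con 1ℚ
                           :+ (con c6 :- (con 1ℚ :+ (con c2 :+ S) :- R)) :* con 1ℚ :* con 1ℚ)) refl S R ⟩
  (c2 ℚ.+ S ℚ.- 1ℚ) ℚ.* ((c2 ℚ.+ S) ℚ.* (c2 ℚ.+ S) ℚ.- c3 ℚ.* (c2 ℚ.+ S) ℚ.* 1ℚ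
                         ℚ.+ (c6 ℚ.- (1ℚ ℚ.+ (c2 ℚ.+ S) ℚ.- R)) ℚ.* 1ℚ ℚ.* 1ℚ)
    ≡⟨ cong (λ P → (P ℚ.- 1ℚ) ℚ.* (P ℚ.* P ℚ.- c3 ℚ.* P ℚ.* 1ℚ ℚ.+ (c6 ℚ.- (1ℚ ℚ.+ P ℚ.- R)) ℚ.* 1ℚ ℚ.* 1ℚ))
            (sym P≡2+S) ⟩
  (P ℚ.- 1ℚ) ℚ.* (P ℚ.* P ℚ.- c3 ℚ.* P ℚ.* 1ℚ ℚ.+ (c6 ℚ.- (1ℚ ℚ.+ P ℚ.- R)) ℚ.* 1ℚ ℚ.* 1ℚ)
    ≡⟨ cong (λ H → (P ℚ.- 1ℚ) ℚ.* (P ℚ.* P ℚ.- c3 ℚ.* P ℚ.* 1ℚ ℚ.+ (c6 ℚ.- H) ℚ.* 1ℚ ℚ.* 1ℚ)) H≡1+P-R ⟨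
  (P ℚ.- 1ℚ) ℚ.* (P ℚ.* P ℚ.- c3 ℚ.* P ℚ.* 1ℚ ℚ.+ (c6 ℚ.- H) ℚ.* 1ℚ ℚ.* 1ℚ)
    ≡⟨ cong (λ w → (P ℚ.- w) ℚ.* (P ℚ.* P ℚ.- c3 ℚ.* P ℚ.* w ℚ.+ (c6 ℚ.- H) ℚ.* w ℚ.* w)) Pu≡1 ⟨
  (P ℚ.- P ℚ.* u) ℚ.* (P ℚ.* P ℚ.- c3 ℚ.* P ℚ.* (P ℚ.* u) ℚ.+ (c6 ℚ.- H) ℚ.* (P ℚ.* u) ℚ.* (P ℚ.* u))
    ≡⟨ solve 3 (λ P u H → P :* P :* P :* ((con 1ℚ :- u) :* ((con 1ℚ :- con c3 :* u) :+ (con c6 :- H) :* (u :* u))) :=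
                           (P :- P :* u) :* (P :* P :- con c3 :* P :* (P :* u) :+ (con c6 :- H) :* (P :* u) :* (P :* u)))
               refl P u H ⟨
  P ℚ.* P ℚ.* P ℚ.* ((1ℚ ℚ.- u) ℚ.* ((1ℚ ℚ.- c3 ℚ.* u) ℚ.+ (c6 ℚ.- H) ℚ.* (u ℚ.* u))) ∎
  where
  open ℚ-Solver
  H≡1+P-R : H ≡ 1ℚ ℚ.+ P ℚ.- R
  H≡1+P-R = trans (solve 2 (λ H R → H := H :+ R :- R) refl H R) (cong (ℚ._- R) H+R≡1+P)

localFactor-identity : ∀ p r → 1 < p → h p ℤ.+ + r ≡ + suc p →
  fromℕ ((p ∸ 1) * ((p ∸ 2) * (p ∸ 2) + 1 + r)) ≡ fromℕ (p * p * p) ℚ.* localFactor p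
localFactor-identity (suc zero) r (s≤s ()) _
localFactor-identity (suc (suc s)) r _ h+r≡1+p = begin
  fromℕ (suc s * (s * s + 1 + r))
    ≡⟨ trans (fromℕ-* (suc s) (s * s + 1 + r)) (cong₂ ℚ._*_ (fromℕ-+ 1 s)
         (trans (fromℕ-+ (s * s + 1) r) (cong (ℚ._+ R) (trans (fromℕ-+ (s * s) 1) (cong (ℚ._+ 1ℚ) (fromℕ-* s s)))))) ⟩
  (1ℚ ℚ.+ S) ℚ.* (S ℚ.* S ℚ.+ 1ℚ ℚ.+ R)
    ≡⟨ localFactor-algebra P S R H u (fromℕ-+ 2 s) (n*1/n≡1 (suc s)) H+R≡1+P ⟩
  P ℚ.* P ℚ.* P ℚ.* ((1ℚ ℚ.- u) ℚ.* ((1ℚ ℚ.- c3 ℚ.* u) ℚ.+ (c6 ℚ.- H) ℚ.* (u ℚ.* u)))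
    ≡⟨ cong₂ (λ x y → x ℚ.* ((1ℚ ℚ.- u) ℚ.* ((1ℚ ℚ.- y) ℚ.+ (c6 ℚ.- H) ℚ.* (u ℚ.* u)))) P³≡ (/≡fromℤ*1/ (+ 3) (suc s)) ⟨
  fromℕ (p * p * p) ℚ.* ((1ℚ ℚ.- u) ℚ.* ((1ℚ ℚ.- + 3 / p) ℚ.+ (c6 ℚ.- H) ℚ.* (u ℚ.* u)))
    ≡⟨ cong (λ x → fromℕ (p * p * p) ℚ.* ((1ℚ ℚ.- u) ℚ.* ((1ℚ ℚ.- + 3 / p) ℚ.+ x))) [6-h]/p²≡ ⟨
  fromℕ (p * p * p) ℚ.* localFactor p ∎
  where
  p : ℕ
  p = 2 + s
  P S R H u : ℚ
  P = fromℕ p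
  S = fromℕ s
  R = fromℕ r
  H = fromℤ (h p)
  u = + 1 / p
  H+R≡1+P : H ℚ.+ R ≡ 1ℚ ℚ.+ P
  H+R≡1+P = trans (sym (fromℤ-+ (h p) (+ r))) (trans (cong fromℤ h+r≡1+p) (fromℕ-+ 1 p))
  P³≡ : fromℕ (p * p * p) ≡ P ℚ.* P ℚ.* P
  P³≡ = trans (fromℕ-* (p * p) p) (cong (ℚ._* P) (fromℕ-* p p))
  [6-h]/p²≡ : (+ 6 ℤ.- h p) / (p * p) ≡ (c6 ℚ.- H) ℚ.* (u ℚ.* u)
  [6-h]/p²≡ = trans (/≡fromℤ*1/ (+ 6 ℤ.- h p) _)
                    (cong₂ ℚ._*_ (fromℤ-- (+ 6) (h p)) (1/[m*n]≡1/m*1/n (suc s) (suc s)))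

-- Both sides along a prime factorisation

Φ-prime-rational : ∀ {p} → Prime p → fromℕ (Φ p) ≡ fromℕ (p * p * p) ℚ.* localFactor p
Φ-prime-rational {p} p-prime = trans (cong fromℕ (Φ-prime p-prime))
  (localFactor-identity p (#cyclo₃-roots p) (1<prime p-prime) (h+#cyclo₃-roots≡1+p p-prime))

private
  cube-* : ∀ k m → k * m * (k * m) * (k * m) ≡ k * k * k * (m * m * m)
  cube-* = solve-∀

rhs-∣ : ∀ k m .{{_ : NonZero k}} .{{_ : NonZero m}} → k ∣ m → rhs (k * m) ≡ fromℕ (k * k * k) ℚ.* rhs m
rhs-∣ k m k∣m = begin
  rhs (k * m)
    ≡⟨ cong₂ (λ x y → fromℕ x ℚ.* y) (cube-* k m) (∏-primeDivisors-∣ localFactor k m k∣m) ⟩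
  fromℕ (k * k * k * (m * m * m)) ℚ.* ∏-primeDivisors localFactor m
    ≡⟨ cong (ℚ._* ∏-primeDivisors localFactor m) (fromℕ-* (k * k * k) (m * m * m)) ⟩
  fromℕ (k * k * k) ℚ.* fromℕ (m * m * m) ℚ.* ∏-primeDivisors localFactor m
    ≡⟨ ℚ.*-assoc (fromℕ (k * k * k)) (fromℕ (m * m * m)) (∏-primeDivisors localFactor m) ⟩
  fromℕ (k * k * k) ℚ.* rhs m ∎

rhs-coprime : ∀ {p} m .{{_ : NonZero m}} → Prime p → ¬ p ∣ m →
              rhs (p * m) ≡ (fromℕ (p * p * p) ℚ.* localFactor p) ℚ.* rhs m
rhs-coprime {p} m p-prime p∤m = begin
  rhs (p * m)
    ≡⟨ cong₂ (λ x y → fromℕ x ℚ.* y) (cube-* p m) (∏-primeDivisors-coprime localFactor m p-prime p∤m) ⟩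
  fromℕ (p * p * p * (m * m * m)) ℚ.* (localFactor p ℚ.* ∏-primeDivisors localFactor m)
    ≡⟨ cong (ℚ._* (localFactor p ℚ.* ∏-primeDivisors localFactor m)) (fromℕ-* (p * p * p) (m * m * m)) ⟩
  fromℕ (p * p * p) ℚ.* fromℕ (m * m * m) ℚ.* (localFactor p ℚ.* ∏-primeDivisors localFactor m)
    ≡⟨ ℚ-*-interchange (fromℕ (p * p * p)) (fromℕ (m * m * m)) (localFactor p) (∏-primeDivisors localFactor m) ⟩
  (fromℕ (p * p * p) ℚ.* localFactor p) ℚ.* rhs m
    ∎

Φ≡rhs-∣ : ∀ k m .{{_ : NonZero k}} .{{_ : NonZero m}} → k ∣ m →
          fromℕ (Φ m) ≡ rhs m → fromℕ (Φ (k * m)) ≡ rhs (k * m)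
Φ≡rhs-∣ k m k∣m Φ≡rhs = begin
  fromℕ (Φ (k * m))                       ≡⟨ cong fromℕ (Φ-∣ k m k∣m) ⟩
  fromℕ (k * k * k * Φ m)                   ≡⟨ fromℕ-* (k * k * k) (Φ m) ⟩
  fromℕ (k * k * k) ℚ.* fromℕ (Φ m)           ≡⟨ cong (fromℕ (k * k * k) ℚ.*_) Φ≡rhs ⟩
  fromℕ (k * k * k) ℚ.* rhs m                 ≡⟨ rhs-∣ k m k∣m ⟨
  rhs (k * m)                             ∎

Φ≡rhs-coprime : ∀ {p} m .{{_ : NonZero m}} → Prime p → ¬ p ∣ m →
                fromℕ (Φ m) ≡ rhs m → fromℕ (Φ (p * m)) ≡ rhs (p * m)
Φ≡rhs-coprime {p} m p-prime p∤m Φ≡rhs = begin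
  fromℕ (Φ (p * m))
    ≡⟨ cong fromℕ (Φ-coprime p m (prime∤⇒coprime p-prime p∤m)) ⟩
  fromℕ (Φ p * Φ m)
    ≡⟨ fromℕ-* (Φ p) (Φ m) ⟩
  fromℕ (Φ p) ℚ.* fromℕ (Φ m)
    ≡⟨ cong₂ ℚ._*_ (Φ-prime-rational p-prime) Φ≡rhs ⟩
  (fromℕ (p * p * p) ℚ.* localFactor p) ℚ.* rhs m
    ≡⟨ rhs-coprime m p-prime p∤m ⟨
  rhs (p * m) ∎
  where
  instance
    p≢0 : NonZero p
    p≢0 = prime⇒nonZero p-prime

Φ≡rhs-product : ∀ ps → All Prime ps → fromℕ (Φ (product ps)) ≡ rhs (product ps)
Φ≡rhs-product []       []                   = refl
Φ≡rhs-product (p ∷ ps) (p-prime ∷ ps-prime) = step (p ∣? product ps)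
  where
  instance
    p≢0 : NonZero p
    p≢0 = prime⇒nonZero p-prime
    ∏ps≢0 : NonZero (product ps)
    ∏ps≢0 = productOfPrimes≢0 ps-prime
  step : Dec (p ∣ product ps) → fromℕ (Φ (p * product ps)) ≡ rhs (p * product ps)
  step (yes p∣m) = Φ≡rhs-∣ p (product ps) p∣m (Φ≡rhs-product ps ps-prime)
  step (no p∤m)  = Φ≡rhs-coprime (product ps) p-prime p∤m (Φ≡rhs-product ps ps-prime)

mainTheorem10 : (n : ℕ) → n ≥ 1 → (+ phi123 n) / 1 ≡ rhs n
mainTheorem10 n@(suc _) _ = begin
  fromℕ (phi123 n)
    ≡⟨ cong fromℕ (phi123≡Φ n) ⟩
  fromℕ (Φ n)
    ≡⟨ subst (λ k → fromℕ (Φ k) ≡ rhs k) (sym isFactorisation) (Φ≡rhs-product factors factorsPrime) ⟩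
  rhs n ∎
  where open PrimeFactorisation (factorise n)
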